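{- Let $m \geq n$ be positive even integers and let $K_{m,n}$ be the complete bipartite graph with parts of cardinality $m$ and $n$. Then $EBI(K_{m,2}) = \{0\}$. For $n \geq 4$, let $k = \left\lfloor \frac{mn}{n+2} \right\rfloor$, $k' = \frac{mn}{2} \bmod \left(\frac{n}{2}+1\right)$, $j = \left\lfloor \frac{mn}{m+2} \right\rfloor$, and $j' = \frac{mn}{2} \bmod \left(\frac{m}{2}+1\right)$. Then \[ EBI(K_{m,n}) = \begin{cases} \{0,1,\dots, 2(k+j)+2-m-n\}, & \text{if } k' = \frac{n}{2} \text{ and } j' = \frac{m}{2},\\ \{0,1,\dots, 2(k+j)+1-m-n\}, & \text{if either } k' = \frac{n}{2} \text{ or } j' = \frac{m}{2},\\ \{0,1,\dots, 2(k+j)-m-n\}, & \text{if } k' < \frac{n}{2} \text{ and } j' < \frac{m}{2}. \end{cases} \] Here $x \bmod y$ denotes the remainder of $x$ upon division by $y$ (division algorithm).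
   Context: Let $G$ be a graph with vertex set $V$ and edge set $E$. A binary edge-labeling is a function $f: E \to \{0,1\}$; an edge $e$ is an $i$-edge if $f(e)=i$, and $e(i)$ denotes the number of $i$-edges. The labeling $f$ is edge-friendly if $|e(1)-e(0)| \leq 1$. For $v \in V$, $\deg_i(v)$ is the number of $i$-edges incident with $v$. An edge-friendly labeling induces a partial vertex labeling: $v$ is labeled $1$ if $\deg_1(v) > \deg_0(v)$, labeled $0$ if $\deg_0(v) > \deg_1(v)$, and unlabeled if $\deg_1(v) = \deg_0(v)$. Let $v(i)$ be the number of vertices labeled $i$. The edge-balanced index set of $G$ is $EBI(G) = \{ |v(1)-v(0)| : f \text{ is an edge-friendly labeling of } G\}$. -}

module Defs where

open import Data.Bool using (Bool; true; false; not)
open import Data.Nat using (ℕ; zero; suc; _+_; _*_; _<_; _≤_; ∣_-_∣; _<?_)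
open import Data.Fin using (Fin; zero; suc)
open import Data.Product using (Σ; _×_)
open import Relation.Nullary.Decidable using (⌊_⌋)
open import Relation.Binary.PropositionalEquality using (_≡_)

bit : Bool → ℕ
bit true  = 1
bit false = 0

countTrue : ∀ {r} → (Fin r → Bool) → ℕ
countTrue {zero}  b = 0
countTrue {suc r} b = bit (b zero) + countTrue (λ i → b (suc i))

countFalse : ∀ {r} → (Fin r → Bool) → ℕ
countFalse b = countTrue (λ i → not (b i))

sumFin : ∀ {r} → (Fin r → ℕ) → ℕ
sumFin {zero}  g = 0
sumFin {suc r} g = g zero + sumFin (λ i → g (suc i))

-- The complete bipartite graph K_{m,n}: vertex set Fin m ⊎ Fin n (parts
-- of cardinality m and n), edge set Fin m × Fin n (edge (a,b) joins left
-- vertex a and right vertex b).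
EdgeLabeling : ℕ → ℕ → Set
EdgeLabeling m n = Fin m → Fin n → Bool   -- true = 1-edge, false = 0-edge

module _ {m n : ℕ} (f : EdgeLabeling m n) where
  e1 : ℕ
  e1 = sumFin (λ a → countTrue (f a))
  e0 : ℕ
  e0 = sumFin (λ a → countFalse (f a))

  edgeFriendly : Set
  edgeFriendly = ∣ e1 - e0 ∣ ≤ 1

  degL1 degL0 : Fin m → ℕ
  degL1 a = countTrue (f a)
  degL0 a = countFalse (f a)
  degR1 degR0 : Fin n → ℕ
  degR1 b = countTrue (λ a → f a b)
  degR0 b = countFalse (λ a → f a b)

  v1 : ℕ
  v1 = countTrue (λ a → ⌊ degL0 a <? degL1 a ⌋) + countTrue (λ b → ⌊ degR0 b <? degR1 b ⌋)
  v0 : ℕ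
  v0 = countTrue (λ a → ⌊ degL1 a <? degL0 a ⌋) + countTrue (λ b → ⌊ degR1 b <? degR0 b ⌋)

EBI : ℕ → ℕ → ℕ → Set
EBI m n x = Σ (EdgeLabeling m n) (λ f → edgeFriendly f × ∣ v1 f - v0 f ∣ ≡ x)

module Submission where

-- Every left vertex has degree 2H and every right vertex degree 2G, and an
-- edge-friendly labeling has exactly mH 1-edges.  A vertex of degree 2Y is
-- labeled 1 iff its 1-degree exceeds Y and 0 iff it is below Y, so v(1) − v(0)
-- is the sum over both sides of (#1-degrees above the mean) − (#below it).
--
-- Upper bound (excess-bound, ebi-upper): X numbers with mean Y ≥ 1 have at most
-- opt X Y = 2⌊XY/(Y+1)⌋ + [XY mod (Y+1) = Y] − X more entries above Y than
-- below; applied to 1- and 0-degrees on both sides, |v(1) − v(0)| ≤ opt m H + opt n G.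
-- Lower bound (Realisation): an extremal row sequence (rows of degree H + 1, one
-- remainder row, then empty rows) is moved one unit at a time to reach every
-- row excess t ≤ opt m H (Rows.row-sequence); filling rows cyclically into the
-- first L columns (Cyclic) gives balanced columns for L = n and extremal
-- columns for L = j or j + 1.  With a transposition this covers every value.

open import Defs
open import Data.Bool using (Bool; true; false; not; _∧_; _∨_; if_then_else_)
open import Data.Nat using (ℕ; zero; suc; _+_; _*_; _∸_; _<_; _≤_; z≤n; s≤s; _<?_; _≤?_; _≟_; ∣_-_∣; _/_; _%_; >-nonZero)
open import Data.Nat.Properties
open import Data.Nat.DivMod using (m≡m%n+[m/n]*n; m%n<n; [m+kn]%n≡m%n; m<n⇒m%n≡m; m<n*o⇒m/o<n; m*n/n≡m; m*n/o*n≡m/o; /-congˡ)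
open import Data.Nat.Tactic.RingSolver using (solve-∀)
open import Data.Fin using (Fin; zero; suc; toℕ)
open import Data.Product using (Σ; _×_; _,_; proj₁; proj₂)
open import Data.Sum using (_⊎_; inj₁; inj₂)
open import Data.Empty using (⊥; ⊥-elim)
open import Relation.Nullary using (¬_; Dec; yes; no)
open import Relation.Nullary.Decidable using (⌊_⌋; isYes≗does; does-⇔)
open import Algebra.Properties.CommutativeSemigroup +-commutativeSemigroup using () renaming (interchange to +-interchange)
open import Relation.Binary.PropositionalEquality hiding ([_])
open import Relation.Binary.Definitions using (tri<; tri≈; tri>)
open import Function.Bundles using (_⇔_; mk⇔; Equivalence)

sumFin-ext : ∀ {r} {g h : Fin r → ℕ} → (∀ i → g i ≡ h i) → sumFin g ≡ sumFin h
sumFin-ext {zero}  eq = refl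
sumFin-ext {suc r} eq = cong₂ _+_ (eq zero) (sumFin-ext (λ i → eq (suc i)))

sumFin-mono : ∀ {r} {g h : Fin r → ℕ} → (∀ i → g i ≤ h i) → sumFin g ≤ sumFin h
sumFin-mono {zero}  le = z≤n
sumFin-mono {suc r} le = +-mono-≤ (le zero) (sumFin-mono (λ i → le (suc i)))

sumFin-+ : ∀ {r} (g h : Fin r → ℕ) → sumFin (λ i → g i + h i) ≡ sumFin g + sumFin h
sumFin-+ {zero}  g h = refl
sumFin-+ {suc r} g h = begin
  g zero + h zero + sumFin (λ i → g (suc i) + h (suc i))
    ≡⟨ cong (g zero + h zero +_) (sumFin-+ (λ i → g (suc i)) (λ i → h (suc i))) ⟩
  g zero + h zero + (sumFin (λ i → g (suc i)) + sumFin (λ i → h (suc i)))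
    ≡⟨ +-interchange (g zero) (h zero) _ _ ⟩
  sumFin g + sumFin h ∎
  where open ≡-Reasoning

sumFin-const : ∀ r c → sumFin {r} (λ _ → c) ≡ r * c
sumFin-const zero    c = refl
sumFin-const (suc r) c = cong (c +_) (sumFin-const r c)

sumFin-*ˡ : ∀ {r} c (g : Fin r → ℕ) → sumFin (λ i → c * g i) ≡ c * sumFin g
sumFin-*ˡ {zero}  c g = sym (*-zeroʳ c)
sumFin-*ˡ {suc r} c g =
  trans (cong (c * g zero +_) (sumFin-*ˡ c (λ i → g (suc i)))) (sym (*-distribˡ-+ c (g zero) _))

sumFin-swap : ∀ {M N} (F : Fin M → Fin N → ℕ) →
  sumFin (λ a → sumFin (F a)) ≡ sumFin (λ b → sumFin (λ a → F a b))
sumFin-swap {zero} {N} F = sym (trans (sumFin-const N 0) (*-zeroʳ N))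
sumFin-swap {suc M} F = trans (cong (sumFin (F zero) +_) (sumFin-swap (λ a → F (suc a))))
  (sym (sumFin-+ (F zero) (λ b → sumFin (λ a → F (suc a) b))))

countTrue-sum : ∀ {r} (b : Fin r → Bool) → countTrue b ≡ sumFin (λ i → bit (b i))
countTrue-sum {zero}  b = refl
countTrue-sum {suc r} b = cong (bit (b zero) +_) (countTrue-sum (λ i → b (suc i)))

countTrue-ext : ∀ {r} {g h : Fin r → Bool} → (∀ i → g i ≡ h i) → countTrue g ≡ countTrue h
countTrue-ext {g = g} {h} eq =
  trans (countTrue-sum g) (trans (sumFin-ext (λ i → cong bit (eq i))) (sym (countTrue-sum h)))

countTrue+countFalse : ∀ {r} (b : Fin r → Bool) → countTrue b + countFalse b ≡ r
countTrue+countFalse {r} b = begin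
  countTrue b + countFalse b
    ≡⟨ cong₂ _+_ (countTrue-sum b) (countTrue-sum (λ i → not (b i))) ⟩
  sumFin (λ i → bit (b i)) + sumFin (λ i → bit (not (b i)))
    ≡⟨ sym (sumFin-+ (λ i → bit (b i)) (λ i → bit (not (b i)))) ⟩
  sumFin (λ i → bit (b i) + bit (not (b i)))
    ≡⟨ sumFin-ext (λ i → bit+bit-not (b i)) ⟩
  sumFin {r} (λ _ → 1)
    ≡⟨ trans (sumFin-const r 1) (*-identityʳ r) ⟩
  r ∎
  where
  open ≡-Reasoning
  bit+bit-not : ∀ x → bit x + bit (not x) ≡ 1
  bit+bit-not true  = refl
  bit+bit-not false = refl

-- sumBelow φ A = φ 0 + φ 1 + … + φ (A - 1).  Sequences indexed by ℕ are more
-- convenient than Fin for the explicit constructions below.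
sumBelow : (ℕ → ℕ) → ℕ → ℕ
sumBelow φ zero    = 0
sumBelow φ (suc A) = φ 0 + sumBelow (λ x → φ (suc x)) A

sumFin-toℕ : ∀ A (φ : ℕ → ℕ) → sumFin {A} (λ i → φ (toℕ i)) ≡ sumBelow φ A
sumFin-toℕ zero    φ = refl
sumFin-toℕ (suc A) φ = cong (φ 0 +_) (sumFin-toℕ A (λ x → φ (suc x)))

countTrue-toℕ : ∀ A (p : ℕ → Bool) → countTrue {A} (λ i → p (toℕ i)) ≡ sumBelow (λ x → bit (p x)) A
countTrue-toℕ A p = trans (countTrue-sum {A} (λ i → p (toℕ i))) (sumFin-toℕ A (λ x → bit (p x)))

sumBelow-ext : ∀ A {φ ψ : ℕ → ℕ} → (∀ x → x < A → φ x ≡ ψ x) → sumBelow φ A ≡ sumBelow ψ A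
sumBelow-ext zero    eq = refl
sumBelow-ext (suc A) eq = cong₂ _+_ (eq 0 (s≤s z≤n)) (sumBelow-ext A (λ x x<A → eq (suc x) (s≤s x<A)))

sumBelow-+ : ∀ A (φ ψ : ℕ → ℕ) → sumBelow (λ x → φ x + ψ x) A ≡ sumBelow φ A + sumBelow ψ A
sumBelow-+ zero    φ ψ = refl
sumBelow-+ (suc A) φ ψ =
  trans (cong ((φ 0 + ψ 0) +_) (sumBelow-+ A (λ x → φ (suc x)) (λ x → ψ (suc x))))
        (+-interchange (φ 0) (ψ 0) _ _)

sumBelow-const : ∀ A c → sumBelow (λ _ → c) A ≡ A * c
sumBelow-const zero    c = refl
sumBelow-const (suc A) c = cong (c +_) (sumBelow-const A c)

sumBelow-zero : ∀ A {φ : ℕ → ℕ} → (∀ x → x < A → φ x ≡ 0) → sumBelow φ A ≡ 0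
sumBelow-zero A eq = trans (sumBelow-ext A eq) (trans (sumBelow-const A 0) (*-zeroʳ A))

sumBelow-split : ∀ A B (φ : ℕ → ℕ) → sumBelow φ (A + B) ≡ sumBelow φ A + sumBelow (λ x → φ (A + x)) B
sumBelow-split zero    B φ = refl
sumBelow-split (suc A) B φ =
  trans (cong (φ 0 +_) (sumBelow-split A B (λ x → φ (suc x)))) (sym (+-assoc (φ 0) _ _))

sumBelow-snoc : ∀ A (φ : ℕ → ℕ) → sumBelow φ (suc A) ≡ sumBelow φ A + φ A
sumBelow-snoc A φ = begin
  sumBelow φ (suc A)                   ≡⟨ cong (sumBelow φ) (+-comm 1 A) ⟩
  sumBelow φ (A + 1)                   ≡⟨ sumBelow-split A 1 φ ⟩
  sumBelow φ A + (φ (A + 0) + 0)       ≡⟨ cong (sumBelow φ A +_) (trans (+-identityʳ _) (cong φ (+-identityʳ A))) ⟩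
  sumBelow φ A + φ A                   ∎
  where open ≡-Reasoning

sumBelow-point : ∀ A a (φ ψ : ℕ → ℕ) → a < A → (∀ x → x < A → x ≢ a → φ x ≡ ψ x) →
  sumBelow φ A + ψ a ≡ sumBelow ψ A + φ a
sumBelow-point (suc A) zero φ ψ _ eq = begin
  φ 0 + sumBelow (λ x → φ (suc x)) A + ψ 0 ≡⟨ cong (λ s → φ 0 + s + ψ 0) rest ⟩
  φ 0 + S + ψ 0                            ≡⟨ swap-ends (φ 0) (ψ 0) S ⟩
  ψ 0 + S + φ 0                            ∎
  where
  open ≡-Reasoning
  S = sumBelow (λ x → ψ (suc x)) A
  rest : sumBelow (λ x → φ (suc x)) A ≡ S
  rest = sumBelow-ext A (λ x x<A → eq (suc x) (s≤s x<A) (λ ()))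
  swap-ends : ∀ a b c → a + c + b ≡ b + c + a
  swap-ends = solve-∀
sumBelow-point (suc A) (suc a) φ ψ (s≤s a<A) eq = begin
  φ 0 + sumBelow φ′ A + ψ (suc a)   ≡⟨ +-assoc (φ 0) _ _ ⟩
  φ 0 + (sumBelow φ′ A + ψ′ a)      ≡⟨ cong (φ 0 +_) (sumBelow-point A a φ′ ψ′ a<A eq′) ⟩
  φ 0 + (sumBelow ψ′ A + φ′ a)      ≡⟨ sym (+-assoc (φ 0) _ _) ⟩
  φ 0 + sumBelow ψ′ A + φ′ a        ≡⟨ cong (λ z → z + sumBelow ψ′ A + φ′ a) (eq 0 (s≤s z≤n) (λ ())) ⟩
  ψ 0 + sumBelow ψ′ A + φ (suc a)   ∎
  where
  open ≡-Reasoning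
  φ′ ψ′ : ℕ → ℕ
  φ′ x = φ (suc x)
  ψ′ x = ψ (suc x)
  eq′ : ∀ x → x < A → x ≢ a → φ′ x ≡ ψ′ x
  eq′ x x<A x≢a = eq (suc x) (s≤s x<A) (λ e → x≢a (suc-injective e))

sumBelow-piecewise : ∀ M k (φ : ℕ → ℕ) {u v w} → k < M →
  (∀ x → x < k → φ x ≡ u) → φ k ≡ v → (∀ x → k < x → φ x ≡ w) →
  sumBelow φ M ≡ k * u + v + (M ∸ suc k) * w
sumBelow-piecewise M k φ {u} {v} {w} k<M φu φv φw = begin
  sumBelow φ M
    ≡⟨ cong (sumBelow φ) M≡k+1+R ⟩
  sumBelow φ (k + suc R)
    ≡⟨ sumBelow-split k (suc R) φ ⟩
  sumBelow φ k + (φ (k + 0) + sumBelow (λ x → φ (k + suc x)) R)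
    ≡⟨ cong₂ _+_ initial (cong₂ _+_ (trans (cong φ (+-identityʳ k)) φv) final) ⟩
  k * u + (v + R * w)
    ≡⟨ sym (+-assoc (k * u) v _) ⟩
  k * u + v + R * w ∎
  where
  open ≡-Reasoning
  R = M ∸ suc k
  M≡k+1+R : M ≡ k + suc R
  M≡k+1+R = trans (sym (m+[n∸m]≡n k<M)) (sym (+-suc k R))
  initial : sumBelow φ k ≡ k * u
  initial = trans (sumBelow-ext k φu) (sumBelow-const k u)
  final : sumBelow (λ x → φ (k + suc x)) R ≡ R * w
  final = trans (sumBelow-ext R (λ x _ → φw (k + suc x) (m<m+n k (s≤s z≤n)))) (sumBelow-const R w)

[_<_] : ℕ → ℕ → ℕ
[ a < b ] = bit ⌊ a <? b ⌋

[<]-yes : ∀ {a b} → a < b → [ a < b ] ≡ 1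
[<]-yes {a} {b} a<b with a <? b
... | yes _  = refl
... | no a≮b = ⊥-elim (a≮b a<b)

[<]-no : ∀ {a b} → ¬ a < b → [ a < b ] ≡ 0
[<]-no {a} {b} a≮b with a <? b
... | yes a<b = ⊥-elim (a≮b a<b)
... | no _    = refl

[<]-positive : ∀ {a b} → 0 < [ a < b ] → a < b
[<]-positive {a} {b} pos with a <? b
... | yes a<b = a<b

[<]-suc : ∀ a b → [ suc a < suc b ] ≡ [ a < b ]
[<]-suc a b with a <? b
... | yes a<b = [<]-yes (s≤s a<b)
... | no a≮b  = [<]-no (λ { (s≤s a<b) → a≮b a<b })

sumBelow-[<] : ∀ N c → c ≤ N → sumBelow (λ x → [ x < c ]) N ≡ c
sumBelow-[<] zero    .zero   z≤n       = refl
sumBelow-[<] (suc N) zero    _         = sumBelow-zero (suc N) (λ x _ → [<]-no {x} {0} λ ())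
sumBelow-[<] (suc N) (suc c) (s≤s c≤N) =
  cong suc (trans (sumBelow-ext N (λ x _ → [<]-suc x c)) (sumBelow-[<] N c c≤N))

≤-from-+ : ∀ {a e b} → a + e ≡ b → a ≤ b
≤-from-+ {a} {e} refl = m≤m+n a e

-- The extremal parameters of X entries with mean Y:  X·Y = rem + quo·(Y+1),
-- δ records whether rem = Y, and opt X Y = 2·quo + δ − X is the largest
-- possible excess (#entries above Y) − (#entries below Y).
quo rem δ opt : ℕ → ℕ → ℕ
quo X Y = (X * Y) / suc Y
rem X Y = (X * Y) % suc Y
δ   X Y = bit ⌊ rem X Y ≟ Y ⌋
opt X Y = (2 * quo X Y + δ X Y) ∸ X

quo-rem : ∀ X Y → X * Y ≡ rem X Y + quo X Y * suc Y
quo-rem X Y = m≡m%n+[m/n]*n (X * Y) (suc Y)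

rem< : ∀ X Y → rem X Y < suc Y
rem< X Y = m%n<n (X * Y) (suc Y)

δ-yes : ∀ X Y → rem X Y ≡ Y → δ X Y ≡ 1
δ-yes X Y e with rem X Y ≟ Y
... | yes _ = refl
... | no ne = ⊥-elim (ne e)

δ-no : ∀ X Y → rem X Y ≢ Y → δ X Y ≡ 0
δ-no X Y ne with rem X Y ≟ Y
... | yes e = ⊥-elim (ne e)
... | no _  = refl

divmod-unique : ∀ {r q r′ q′} d → r + q * suc d ≡ r′ + q′ * suc d → r < suc d → r′ < suc d → r ≡ r′ × q ≡ q′
divmod-unique {r} {q} {r′} {q′} d e r< r′< =
  r≡r′ , *-cancelʳ-≡ q q′ (suc d) (+-cancelˡ-≡ r _ _ (trans e (cong (_+ q′ * suc d) (sym r≡r′))))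
  where
  mod : ∀ r q → r < suc d → (r + q * suc d) % suc d ≡ r
  mod r q r< = trans ([m+kn]%n≡m%n r q (suc d)) (m<n⇒m%n≡m r<)
  r≡r′ : r ≡ r′
  r≡r′ = trans (sym (mod r q r<)) (trans (cong (_% suc d) e) (mod r′ q′ r′<))

-- The excess of an extremal sequence: k entries above the mean, b + (X − k − 1)
-- below it, where b + e = 1; then k = b + (X − k − 1) + (2k + e − X).
extremal-excess : ∀ X k b e → k < X → X ≤ 2 * k + e → b + e ≡ 1 →
  k ≡ b + (X ∸ suc k) + (2 * k + e ∸ X)
extremal-excess X k b e k<X X≤ b+e≡1 = +-cancelʳ-≡ X _ _ (begin
  k + X                                   ≡⟨ cong (k +_) (sym (m+[n∸m]≡n k<X)) ⟩
  k + (suc k + R)                         ≡⟨ e₁ R k ⟩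
  1 + R + 2 * k                           ≡⟨ cong (λ z → z + R + 2 * k) (sym b+e≡1) ⟩
  b + e + R + 2 * k                       ≡⟨ e₂ b R k e ⟩
  b + R + (2 * k + e)                     ≡⟨ cong (b + R +_) (sym (m∸n+n≡m X≤)) ⟩
  b + R + ((2 * k + e ∸ X) + X)           ≡⟨ sym (+-assoc (b + R) _ X) ⟩
  b + R + (2 * k + e ∸ X) + X             ∎)
  where
  open ≡-Reasoning
  R = X ∸ suc k
  e₁ : ∀ R k → k + (suc k + R) ≡ 1 + R + 2 * k
  e₁ = solve-∀
  e₂ : ∀ b R k d → b + d + R + 2 * k ≡ b + R + (2 * k + d)
  e₂ = solve-∀

≤-quotient : ∀ {a k r} Y → a * suc Y ≤ r + k * suc Y → r < suc Y → a ≤ k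
≤-quotient {a} {k} {r} Y le r< with a ≤? k
... | yes a≤k = a≤k
... | no a≰k  = ⊥-elim (<⇒≱ r< (+-cancelʳ-≤ (k * suc Y) (suc Y) r
                      (≤-trans (*-monoˡ-≤ (suc Y) (≰⇒> a≰k)) le)))

quo<X : ∀ X Y → 0 < X → quo X Y < X
quo<X X Y X>0 = m<n*o⇒m/o<n (*-monoʳ-< X (n<1+n Y))
  where instance _ = >-nonZero X>0

quo-≥ : ∀ a X Y → a * suc Y ≤ X * Y → a ≤ quo X Y
quo-≥ a X Y le = ≤-quotient Y (≤-trans le (≤-reflexive (quo-rem X Y))) (rem< X Y)

-- For X = 2G and Y ≥ 1, quo X Y ≥ G, so X ≤ 2·quo X Y + δ X Y and
-- opt X Y = 2·quo X Y + δ X Y − X involves no truncation.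
even≤2quo : ∀ G Y → 0 < Y → G + G ≤ 2 * quo (G + G) Y + δ (G + G) Y
even≤2quo G Y Y>0 = ≤-trans (≤-reflexive (cong (G +_) (sym (+-identityʳ G))))
  (≤-trans (*-monoʳ-≤ 2 G≤quo) (m≤m+n _ _))
  where
  G≤quo : G ≤ quo (G + G) Y
  G≤quo = quo-≥ G (G + G) Y (begin
    G * suc Y     ≡⟨ *-suc G Y ⟩
    G + G * Y     ≤⟨ +-monoˡ-≤ (G * Y) (m≤m*n G Y {{>-nonZero Y>0}}) ⟩
    G * Y + G * Y ≡⟨ sym (*-distribʳ-+ Y G G) ⟩
    (G + G) * Y   ∎)
    where open ≤-Reasoning

-- For H, G ≥ 2: H + 1 ≤ quo (2H) G + δ (2H) G.  Indeed (H+1)(G+1) ≤ 2HG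
-- unless H = G = 2, where quo 4 2 = 2 and rem 4 2 = 2 = G.
H<quo+δ : ∀ H G → 2 ≤ H → 2 ≤ G → suc H ≤ quo (H + H) G + δ (H + H) G
H<quo+δ 2 2 _ _ = s≤s (s≤s (s≤s z≤n))
H<quo+δ H@(suc (suc (suc h))) G@(suc (suc g)) _ _ = ≤-trans (quo-≥ (suc H) (H + H) G (≤-from-+ (e h g))) (m≤m+n _ _)
  where
  e : ∀ h g → suc (suc (suc (suc h))) * suc (suc (suc g)) + (2 * g + h + h * g)
            ≡ (suc (suc (suc h)) + suc (suc (suc h))) * suc (suc g)
  e = solve-∀
H<quo+δ 2 G@(suc (suc (suc g))) _ _ = ≤-trans (quo-≥ 3 (2 + 2) G (≤-from-+ (e g))) (m≤m+n _ _)
  where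
  e : ∀ g → 3 * suc (suc (suc (suc g))) + g ≡ (2 + 2) * suc (suc (suc g))
  e = solve-∀
H<quo+δ (suc zero) _ (s≤s ()) _
H<quo+δ (suc (suc _)) (suc zero) _ (s≤s ())

-- If Z·Y ≤ r + D·(Y+1) with r < Y+1 and Y ≥ 1, then Z ≤ 2D + [r = Y]:
-- one entry beyond 2D forces r ≥ Y, two force r ≥ 2Y.
≤-twice-quotient : ∀ y {Z D r} → Z * suc y ≤ r + D * suc (suc y) → r < suc (suc y) →
  Z ≤ 2 * D + bit ⌊ r ≟ suc y ⌋
≤-twice-quotient y {Z} {D} {r} le r< with Z ≤? 2 * D + bit ⌊ r ≟ suc y ⌋
... | yes Z≤ = Z≤
... | no Z≰  = ⊥-elim (impossible (r ≟ Y) Y+εY≤r)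
  where
  Y = suc y
  ε = bit ⌊ r ≟ Y ⌋
  expand : ∀ D e y → suc (2 * D + e) * suc y ≡ suc y + e * suc y + D * suc y + D * suc y
  expand = solve-∀
  regroup : ∀ r D y → r + D * suc (suc y) ≡ r + D + D * suc y
  regroup = solve-∀
  Y+εY+DY≤r+D : Y + ε * Y + D * Y ≤ r + D
  Y+εY+DY≤r+D = +-cancelʳ-≤ (D * Y) _ _
    (subst₂ _≤_ (expand D ε y) (regroup r D y) (≤-trans (*-monoˡ-≤ Y (≰⇒> Z≰)) le))
  Y+εY≤r : Y + ε * Y ≤ r
  Y+εY≤r = +-cancelʳ-≤ D _ _ (≤-trans (+-monoʳ-≤ (Y + ε * Y) (m≤m*n D Y)) Y+εY+DY≤r+D)
  impossible : (d : Dec (r ≡ Y)) → Y + bit ⌊ d ⌋ * Y ≤ r → ⊥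
  impossible (yes refl) le′ = <⇒≱ (m<m+n Y {Y + 0} (s≤s z≤n)) le′
  impossible (no r≢Y)   le′ = r≢Y (≤-antisym (≤-pred r<) (subst (_≤ r) (+-identityʳ Y) le′))

-- Among X entries with mean Y let
-- P lie above Y, Q below and Z = X − P − Q at Y.  The sum condition gives
-- P ≤ Y·Q, hence P(Y+1) + ZY ≤ XY = r + k(Y+1); so P ≤ k and, writing
-- k = P + D, Z ≤ 2D + [r = Y].  Then P + X = 2P + Q + Z ≤ Q + 2k + [r = Y].
excess-arith : ∀ P Q X y k r → P ≤ suc y * Q → P + Q ≤ X →
  X * suc y ≡ r + k * suc (suc y) → r < suc (suc y) →
  P + X ≤ Q + (2 * k + bit ⌊ r ≟ suc y ⌋)
excess-arith P Q X y k r P≤YQ P+Q≤X XY r< = begin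
  P + X                       ≡⟨ cong (P +_) X≡P+Q+Z ⟩
  P + (P + Q + Z)             ≤⟨ +-monoʳ-≤ P (+-monoʳ-≤ (P + Q) Z≤2D+ε) ⟩
  P + (P + Q + (2 * D + ε))   ≡⟨ regroup P Q D ε ⟩
  Q + (2 * (P + D) + ε)       ≡⟨ cong (λ z → Q + (2 * z + ε)) (m+[n∸m]≡n P≤k) ⟩
  Q + (2 * k + ε)             ∎
  where
  open ≤-Reasoning
  Y = suc y
  ε = bit ⌊ r ≟ Y ⌋
  Z = X ∸ (P + Q)
  X≡P+Q+Z : X ≡ P + Q + Z
  X≡P+Q+Z = sym (m+[n∸m]≡n P+Q≤X)
  regroup : ∀ P Q D e → P + (P + Q + (2 * D + e)) ≡ Q + (2 * (P + D) + e)
  regroup = solve-∀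
  sum-bound : P * suc Y + Z * Y ≤ r + k * suc Y
  sum-bound = begin
    P * suc Y + Z * Y       ≡⟨ e₁ P Z y ⟩
    P + P * Y + Z * Y       ≤⟨ +-monoˡ-≤ (Z * Y) (+-monoˡ-≤ (P * Y) P≤YQ) ⟩
    Y * Q + P * Y + Z * Y   ≡⟨ e₂ P Q Z y ⟩
    (P + Q + Z) * Y         ≡⟨ cong (_* Y) (sym X≡P+Q+Z) ⟩
    X * Y                   ≡⟨ XY ⟩
    r + k * suc Y           ∎
    where
    e₁ : ∀ P Z y → P * suc (suc y) + Z * suc y ≡ P + P * suc y + Z * suc y
    e₁ = solve-∀
    e₂ : ∀ P Q Z y → suc y * Q + P * suc y + Z * suc y ≡ (P + Q + Z) * suc y
    e₂ = solve-∀
  P≤k : P ≤ k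
  P≤k = ≤-quotient Y (≤-trans (m≤m+n (P * suc Y) (Z * Y)) sum-bound) r<
  D = k ∸ P
  ZY≤r+D : Z * Y ≤ r + D * suc Y
  ZY≤r+D = +-cancelˡ-≤ (P * suc Y) _ _ (begin
    P * suc Y + Z * Y        ≤⟨ sum-bound ⟩
    r + k * suc Y            ≡⟨ cong (λ z → r + z * suc Y) (sym (m+[n∸m]≡n P≤k)) ⟩
    r + (P + D) * suc Y      ≡⟨ e₃ r P D (suc Y) ⟩
    P * suc Y + (r + D * suc Y) ∎)
    where
    e₃ : ∀ a P D c → a + (P + D) * c ≡ P * c + (a + D * c)
    e₃ = solve-∀
  Z≤2D+ε : Z ≤ 2 * D + ε
  Z≤2D+ε = ≤-twice-quotient y {D = D} ZY≤r+D r<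

#above #below : ∀ {X} → ℕ → (Fin X → ℕ) → ℕ
#above Y d = countTrue (λ a → ⌊ Y <? d a ⌋)
#below Y d = countTrue (λ a → ⌊ d a <? Y ⌋)

excess-entry : ∀ Y d → Y + [ Y < d ] ≤ d + Y * [ d < Y ]
excess-entry Y d with Y <? d | d <? Y
... | yes Y<d | yes d<Y = ⊥-elim (<-asym Y<d d<Y)
... | yes Y<d | no _    = subst₂ _≤_ (+-comm 1 Y) (sym (trans (cong (d +_) (*-zeroʳ Y)) (+-identityʳ d))) Y<d
... | no _    | yes _   = subst₂ _≤_ (sym (+-identityʳ Y)) (sym (cong (d +_) (*-identityʳ Y))) (m≤n+m Y d)
... | no _    | no d≮Y  = subst₂ _≤_ (sym (+-identityʳ Y)) (sym (trans (cong (d +_) (*-zeroʳ Y)) (+-identityʳ d))) (≮⇒≥ d≮Y)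

above+below-entry : ∀ Y d → [ Y < d ] + [ d < Y ] ≤ 1
above+below-entry Y d with Y <? d | d <? Y
... | yes Y<d | yes d<Y = ⊥-elim (<-asym Y<d d<Y)
... | yes _   | no _    = s≤s z≤n
... | no _    | yes _   = s≤s z≤n
... | no _    | no _    = z≤n

≤-+∸ : ∀ P Q X A → P + X ≤ Q + A → P ≤ Q + (A ∸ X)
≤-+∸ P Q X A le with X ≤? A
... | yes X≤A = +-cancelʳ-≤ X P _ (≤-trans le (≤-reflexive (begin
      Q + A               ≡⟨ cong (Q +_) (sym (m∸n+n≡m X≤A)) ⟩
      Q + (A ∸ X + X)     ≡⟨ sym (+-assoc Q (A ∸ X) X) ⟩
      Q + (A ∸ X) + X     ∎)))
  where open ≡-Reasoning
... | no X≰A = ≤-trans (<⇒≤ (+-cancelʳ-< X P Q (≤-<-trans le (+-monoʳ-< Q (≰⇒> X≰A))))) (m≤m+n Q _)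

-- Entries above the mean Y exceed it by at least one, entries below fall short
-- by at most Y; so #above ≤ Y · #below.
#above≤Y*#below : ∀ {X} Y (d : Fin X → ℕ) → sumFin d ≡ X * Y → #above Y d ≤ Y * #below Y d
#above≤Y*#below {X} Y d Σd = +-cancelˡ-≤ (X * Y) _ _ (begin
  X * Y + #above Y d
    ≡⟨ cong₂ _+_ (sym (sumFin-const X Y)) (countTrue-sum (λ a → ⌊ Y <? d a ⌋)) ⟩
  sumFin {X} (λ _ → Y) + sumFin (λ a → [ Y < d a ])
    ≡⟨ sym (sumFin-+ (λ _ → Y) (λ a → [ Y < d a ])) ⟩
  sumFin (λ a → Y + [ Y < d a ])
    ≤⟨ sumFin-mono (λ a → excess-entry Y (d a)) ⟩
  sumFin (λ a → d a + Y * [ d a < Y ])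
    ≡⟨ sumFin-+ d (λ a → Y * [ d a < Y ]) ⟩
  sumFin d + sumFin (λ a → Y * [ d a < Y ])
    ≡⟨ cong₂ _+_ Σd (trans (sumFin-*ˡ Y (λ a → [ d a < Y ])) (cong (Y *_) (sym (countTrue-sum (λ a → ⌊ d a <? Y ⌋))))) ⟩
  X * Y + Y * #below Y d ∎)
  where open ≤-Reasoning

excess-bound : ∀ {X} y (d : Fin X → ℕ) → sumFin d ≡ X * suc y →
  #above (suc y) d ≤ #below (suc y) d + opt X (suc y)
excess-bound {X} y d Σd = ≤-+∸ P Q X _
  (excess-arith P Q X y (quo X Y) (rem X Y) (#above≤Y*#below Y d Σd) P+Q≤X (quo-rem X Y) (rem< X Y))
  where
  Y = suc y
  P = #above Y d
  Q = #below Y d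
  P+Q≤X : P + Q ≤ X
  P+Q≤X = begin
    P + Q
      ≡⟨ cong₂ _+_ (countTrue-sum (λ a → ⌊ Y <? d a ⌋)) (countTrue-sum (λ a → ⌊ d a <? Y ⌋)) ⟩
    sumFin (λ a → [ Y < d a ]) + sumFin (λ a → [ d a < Y ])
      ≡⟨ sym (sumFin-+ (λ a → [ Y < d a ]) (λ a → [ d a < Y ])) ⟩
    sumFin (λ a → [ Y < d a ] + [ d a < Y ])
      ≤⟨ sumFin-mono (λ a → above+below-entry Y (d a)) ⟩
    sumFin {X} (λ _ → 1)
      ≡⟨ trans (sumFin-const X 1) (*-identityʳ X) ⟩
    X ∎
    where open ≤-Reasoning

half-trichotomy : ∀ {Y d e} → d + e ≡ Y + Y →
  (d < Y × Y < e) ⊎ (d ≡ Y × e ≡ Y) ⊎ (Y < d × e < Y)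
half-trichotomy {Y} {d} {e} s with <-cmp d Y
... | tri< d<Y _ _ = inj₁ (d<Y , ≰⇒> λ e≤Y → <-irrefl s (+-mono-<-≤ d<Y e≤Y))
... | tri≈ _ refl _ = inj₂ (inj₁ (refl , +-cancelˡ-≡ d e Y s))
... | tri> _ _ Y<d = inj₂ (inj₂ (Y<d , ≰⇒> λ Y≤e → <-irrefl (sym s) (+-mono-<-≤ Y<d Y≤e)))

isYes-⇔ : ∀ {A B : Set} → A ⇔ B → (a? : Dec A) (b? : Dec B) → ⌊ a? ⌋ ≡ ⌊ b? ⌋
isYes-⇔ A⇔B a? b? = trans (isYes≗does a?) (trans (does-⇔ A⇔B a? b?) (sym (isYes≗does b?)))

label-1 : ∀ {Y d e} → d + e ≡ Y + Y → ⌊ e <? d ⌋ ≡ ⌊ Y <? d ⌋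
label-1 {Y} {d} {e} s = isYes-⇔ (mk⇔ to from) (e <? d) (Y <? d)
  where
  to : e < d → Y < d
  to e<d with half-trichotomy {Y} {d} {e} s
  ... | inj₁ (d<Y , Y<e)        = ⊥-elim (<-asym e<d (<-trans d<Y Y<e))
  ... | inj₂ (inj₁ (refl , refl)) = ⊥-elim (<-irrefl refl e<d)
  ... | inj₂ (inj₂ (Y<d , _))   = Y<d
  from : Y < d → e < d
  from Y<d with half-trichotomy {Y} {d} {e} s
  ... | inj₁ (d<Y , _)          = ⊥-elim (<-asym d<Y Y<d)
  ... | inj₂ (inj₁ (refl , _))  = ⊥-elim (<-irrefl refl Y<d)
  ... | inj₂ (inj₂ (_ , e<Y))   = <-trans e<Y Y<d

label-0 : ∀ {Y d e} → d + e ≡ Y + Y → ⌊ d <? e ⌋ ≡ ⌊ d <? Y ⌋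
label-0 {Y} {d} {e} s = isYes-⇔ (mk⇔ to from) (d <? e) (d <? Y)
  where
  to : d < e → d < Y
  to d<e with half-trichotomy {Y} {d} {e} s
  ... | inj₁ (d<Y , _)          = d<Y
  ... | inj₂ (inj₁ (refl , refl)) = ⊥-elim (<-irrefl refl d<e)
  ... | inj₂ (inj₂ (Y<d , e<Y)) = ⊥-elim (<-asym d<e (<-trans e<Y Y<d))
  from : d < Y → d < e
  from d<Y with half-trichotomy {Y} {d} {e} s
  ... | inj₁ (_ , Y<e)          = <-trans d<Y Y<e
  ... | inj₂ (inj₁ (refl , _))  = ⊥-elim (<-irrefl refl d<Y)
  ... | inj₂ (inj₂ (Y<d , _))   = ⊥-elim (<-asym d<Y Y<d)

complement-above : ∀ {Y d e} → d + e ≡ Y + Y → ⌊ Y <? e ⌋ ≡ ⌊ d <? Y ⌋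
complement-above {Y} {d} {e} s = isYes-⇔ (mk⇔ to from) (Y <? e) (d <? Y)
  where
  to : Y < e → d < Y
  to Y<e with half-trichotomy {Y} {d} {e} s
  ... | inj₁ (d<Y , _)          = d<Y
  ... | inj₂ (inj₁ (_ , refl))  = ⊥-elim (<-irrefl refl Y<e)
  ... | inj₂ (inj₂ (_ , e<Y))   = ⊥-elim (<-asym Y<e e<Y)
  from : d < Y → Y < e
  from d<Y with half-trichotomy {Y} {d} {e} s
  ... | inj₁ (_ , Y<e)          = Y<e
  ... | inj₂ (inj₁ (refl , _))  = ⊥-elim (<-irrefl refl d<Y)
  ... | inj₂ (inj₂ (Y<d , _))   = ⊥-elim (<-asym d<Y Y<d)

#above-complement : ∀ {X} Y (d e : Fin X → ℕ) → (∀ a → d a + e a ≡ Y + Y) → #above Y e ≡ #below Y d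
#above-complement Y d e s = countTrue-ext (λ a → complement-above (s a))

#below-complement : ∀ {X} Y (d e : Fin X → ℕ) → (∀ a → d a + e a ≡ Y + Y) → #below Y e ≡ #above Y d
#below-complement Y d e s = countTrue-ext (λ a →
  trans (sym (label-0 (trans (+-comm (e a) (d a)) (s a)))) (label-1 (s a)))

friendly-half : ∀ a b t → a + b ≡ t + t → ∣ a - b ∣ ≤ 1 → a ≡ t
friendly-half a b t s d with <-cmp a t
... | tri< a<t _ _ = ⊥-elim (<-irrefl s (+-mono-<-≤ a<t b≤t))
  where
  b≤t : b ≤ t
  b≤t = ≤-trans (m≤n+∣n-m∣ b a) (≤-trans (+-monoʳ-≤ a d) (subst (_≤ t) (+-comm 1 a) a<t))
... | tri≈ _ a≡t _ = a≡t
... | tri> _ _ t<a = ⊥-elim (<-irrefl (sym s) (+-mono-<-≤ t<a t≤b))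
  where
  t≤b : t ≤ b
  t≤b = ≤-pred (≤-trans t<a (≤-trans (m≤n+∣m-n∣ a b) (subst (b + ∣ a - b ∣ ≤_) (+-comm b 1) (+-monoʳ-≤ b d))))

∣-∣≤ : ∀ a b c → a ≤ b + c → b ≤ a + c → ∣ a - b ∣ ≤ c
∣-∣≤ a b c a≤b+c b≤a+c with ∣m-n∣≡[m∸n]∨[n∸m] a b
... | inj₁ e = subst (_≤ c) (sym e) (m≤n+o⇒m∸n≤o a b a≤b+c)
... | inj₂ e = subst (_≤ c) (sym e) (m≤n+o⇒m∸n≤o b a b≤a+c)

∣-∣≤-+ : ∀ {a₁ b₁ c₁ a₂ b₂ c₂} → a₁ ≤ b₁ + c₁ × b₁ ≤ a₁ + c₁ → a₂ ≤ b₂ + c₂ × b₂ ≤ a₂ + c₂ →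
  ∣ a₁ + a₂ - b₁ + b₂ ∣ ≤ c₁ + c₂
∣-∣≤-+ {a₁} {b₁} {c₁} {a₂} {b₂} {c₂} (p₁ , q₁) (p₂ , q₂) = ∣-∣≤ _ _ _
  (≤-trans (+-mono-≤ p₁ p₂) (≤-reflexive (+-interchange b₁ c₁ b₂ c₂)))
  (≤-trans (+-mono-≤ q₁ q₂) (≤-reflexive (+-interchange a₁ c₁ a₂ c₂)))

side-bound : ∀ {X} y (d e : Fin X → ℕ) → (∀ a → d a + e a ≡ suc y + suc y) →
  sumFin d ≡ X * suc y → sumFin e ≡ X * suc y →
  #above (suc y) d ≤ #below (suc y) d + opt X (suc y) × #below (suc y) d ≤ #above (suc y) d + opt X (suc y)
side-bound {X} y d e s Σd Σe = excess-bound y d Σd ,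
  subst₂ (λ p q → p ≤ q + opt X (suc y)) (#above-complement _ d e s) (#below-complement _ d e s)
    (excess-bound y e Σe)

module Counts {m n : ℕ} (f : EdgeLabeling m n) where

  e1+e0 : e1 f + e0 f ≡ m * n
  e1+e0 = begin
    e1 f + e0 f
      ≡⟨ sym (sumFin-+ (λ a → countTrue (f a)) (λ a → countFalse (f a))) ⟩
    sumFin (λ a → countTrue (f a) + countFalse (f a))
      ≡⟨ sumFin-ext (λ a → countTrue+countFalse (f a)) ⟩
    sumFin {m} (λ _ → n)
      ≡⟨ sumFin-const m n ⟩
    m * n ∎
    where open ≡-Reasoning

  sum-degR : ∀ (p : Bool → Bool) →
    sumFin (λ b → countTrue (λ a → p (f a b))) ≡ sumFin (λ a → countTrue (λ b → p (f a b)))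
  sum-degR p = begin
    sumFin (λ b → countTrue (λ a → p (f a b)))
      ≡⟨ sumFin-ext (λ b → countTrue-sum (λ a → p (f a b))) ⟩
    sumFin (λ b → sumFin (λ a → bit (p (f a b))))
      ≡⟨ sym (sumFin-swap (λ a b → bit (p (f a b)))) ⟩
    sumFin (λ a → sumFin (λ b → bit (p (f a b))))
      ≡⟨ sumFin-ext (λ a → sym (countTrue-sum (λ b → p (f a b)))) ⟩
    sumFin (λ a → countTrue (λ b → p (f a b))) ∎
    where open ≡-Reasoning

  sum-degR1 : sumFin (degR1 f) ≡ e1 f
  sum-degR1 = sum-degR (λ x → x)

  sum-degR0 : sumFin (degR0 f) ≡ e0 f
  sum-degR0 = sum-degR not

  module Even {H G : ℕ} (n≡2H : n ≡ H + H) (m≡2G : m ≡ G + G) where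

    degL : ∀ a → degL1 f a + degL0 f a ≡ H + H
    degL a = trans (countTrue+countFalse (f a)) n≡2H

    degR : ∀ b → degR1 f b + degR0 f b ≡ G + G
    degR b = trans (countTrue+countFalse (λ a → f a b)) m≡2G

    v1≡ : v1 f ≡ #above H (degL1 f) + #above G (degR1 f)
    v1≡ = cong₂ _+_ (countTrue-ext (λ a → label-1 (degL a))) (countTrue-ext (λ b → label-1 (degR b)))

    v0≡ : v0 f ≡ #below H (degL1 f) + #below G (degR1 f)
    v0≡ = cong₂ _+_ (countTrue-ext (λ a → label-0 (degL a))) (countTrue-ext (λ b → label-0 (degR b)))

    mH≡nG : m * H ≡ n * G
    mH≡nG = begin
      m * H             ≡⟨ cong (_* H) m≡2G ⟩
      (G + G) * H       ≡⟨ e G H ⟩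
      (H + H) * G       ≡⟨ cong (_* G) (sym n≡2H) ⟩
      n * G             ∎
      where
      open ≡-Reasoning
      e : ∀ G H → (G + G) * H ≡ (H + H) * G
      e = solve-∀

    m*n≡mH+mH : m * n ≡ m * H + m * H
    m*n≡mH+mH = trans (cong (m *_) n≡2H) (*-distribˡ-+ m H H)

    friendly-e1 : edgeFriendly f → e1 f ≡ m * H
    friendly-e1 ef = friendly-half (e1 f) (e0 f) (m * H) (trans e1+e0 m*n≡mH+mH) ef

    e1⇒e0 : e1 f ≡ m * H → e0 f ≡ m * H
    e1⇒e0 e = +-cancelˡ-≡ (e1 f) _ _ (trans e1+e0 (trans m*n≡mH+mH (cong (_+ m * H) (sym e))))

    e1⇒friendly : e1 f ≡ m * H → edgeFriendly f
    e1⇒friendly e = subst (_≤ 1) (sym (trans (cong₂ ∣_-_∣ e (e1⇒e0 e)) (∣n-n∣≡0 (m * H)))) z≤n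

    realises : edgeFriendly f → ∀ t c →
      #above H (degL1 f) ≡ #below H (degL1 f) + t → #above G (degR1 f) ≡ #below G (degR1 f) + c →
      EBI m n (t + c)
    realises ef t c rows cols = f , ef , (begin
      ∣ v1 f - v0 f ∣                              ≡⟨ cong₂ ∣_-_∣ v1≡ v0≡ ⟩
      ∣ P₁ + P₂ - Q₁ + Q₂ ∣                        ≡⟨ cong (λ z → ∣ z - Q₁ + Q₂ ∣) (cong₂ _+_ rows cols) ⟩
      ∣ Q₁ + t + (Q₂ + c) - Q₁ + Q₂ ∣              ≡⟨ cong (λ z → ∣ z - Q₁ + Q₂ ∣) (+-interchange Q₁ t Q₂ c) ⟩
      ∣ Q₁ + Q₂ + (t + c) - Q₁ + Q₂ ∣              ≡⟨ ∣-∣-comm (Q₁ + Q₂ + (t + c)) (Q₁ + Q₂) ⟩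
      ∣ Q₁ + Q₂ - Q₁ + Q₂ + (t + c) ∣              ≡⟨ ∣m-m+n∣≡n (Q₁ + Q₂) (t + c) ⟩
      t + c                                        ∎)
      where
      open ≡-Reasoning
      P₁ = #above H (degL1 f)
      P₂ = #above G (degR1 f)
      Q₁ = #below H (degL1 f)
      Q₂ = #below G (degR1 f)

ebi-upper : ∀ {m n} H G → n ≡ H + H → m ≡ G + G → 0 < H → 0 < G →
  ∀ x → EBI m n x → x ≤ opt m H + opt n G
ebi-upper {m} {n} (suc h) (suc g) n≡2H m≡2G _ _ x (f , ef , ∣v1-v0∣≡x) =
  subst (_≤ opt m (suc h) + opt n (suc g)) ∣v1-v0∣≡x
    (subst₂ (λ p q → ∣ p - q ∣ ≤ opt m (suc h) + opt n (suc g)) (sym v1≡) (sym v0≡) (∣-∣≤-+ rows cols))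
  where
  open Counts f
  open Even {suc h} {suc g} n≡2H m≡2G
  Σ1 : e1 f ≡ m * suc h
  Σ1 = friendly-e1 ef
  rows = side-bound h (degL1 f) (degL0 f) degL Σ1 (e1⇒e0 Σ1)
  cols = side-bound g (degR1 f) (degR0 f) degR
    (trans sum-degR1 (trans Σ1 mH≡nG)) (trans sum-degR0 (trans (e1⇒e0 Σ1) mH≡nG))

-- Pointwise identities behind cyclic filling: the block [c, c + r) of
-- columns, and, when it wraps past L, the blocks [c, L) and [0, c + r − L).
block-[<] : ∀ c r b → bit (⌊ c ≤? b ⌋ ∧ ⌊ b <? c + r ⌋) + [ b < c ] ≡ [ b < c + r ]
block-[<] c r b with c ≤? b | b <? c | b <? c + r
... | yes c≤b | yes b<c | _       = ⊥-elim (<⇒≱ b<c c≤b)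
... | yes _   | no _    | yes _   = refl
... | yes _   | no _    | no _    = refl
... | no _    | yes _   | yes _   = refl
... | no _    | yes b<c | no b≮cr = ⊥-elim (b≮cr (<-≤-trans b<c (m≤m+n c r)))
... | no c≰b  | no b≮c  | _       = ⊥-elim (c≰b (≮⇒≥ b≮c))

wrapped-block-[<] : ∀ c r L b → c < L → L ≤ c + r → r ≤ L →
  bit ((⌊ c ≤? b ⌋ ∧ ⌊ b <? L ⌋) ∨ ⌊ b <? c + r ∸ L ⌋) + [ b < c ] ≡ [ b < L ] + [ b < c + r ∸ L ]
wrapped-block-[<] c r L b c<L L≤c+r r≤L with c ≤? b | b <? L | b <? c + r ∸ L | b <? c
... | yes c≤b | _       | _       | yes b<c = ⊥-elim (<⇒≱ b<c c≤b)
... | yes c≤b | _       | yes b<w | no _    = ⊥-elim (<⇒≱ b<w (≤-trans w≤c c≤b))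
  where w≤c = ≤-trans (∸-monoʳ-≤ (c + r) r≤L) (≤-reflexive (m+n∸n≡m c r))
... | yes _   | yes _   | no _    | no _    = refl
... | yes _   | no _    | no _    | no _    = refl
... | no c≰b  | _       | _       | no b≮c  = ⊥-elim (c≰b (≮⇒≥ b≮c))
... | no _    | no b≮L  | _       | yes b<c = ⊥-elim (b≮L (<-trans b<c c<L))
... | no _    | yes _   | yes _   | yes _   = refl
... | no _    | yes _   | no _    | yes _   = refl

-- Rows a = 0, 1, 2, … receive blocks of ρ a consecutive
-- 1-entries among the columns 0, …, L − 1, each block starting where the
-- previous one ended and wrapping around modulo L.  Row a starts at column
-- cursor a, after laps a complete passes through the L columns.  Consequently
-- row a has exactly ρ a ones, and the column sums differ by at most one:
-- column b < L has laps A + [b < cursor A] ones among the first A rows.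
module Cyclic (ρ : ℕ → ℕ) (L : ℕ) where

  next wraps : (c r : ℕ) → Dec (c + r < L) → ℕ
  next  c r (yes _) = c + r
  next  c r (no _)  = c + r ∸ L
  wraps c r (yes _) = 0
  wraps c r (no _)  = 1

  cursor : ℕ → ℕ
  cursor zero    = 0
  cursor (suc a) = next (cursor a) (ρ a) (cursor a + ρ a <? L)

  laps : ℕ → ℕ
  laps zero    = 0
  laps (suc a) = laps a + wraps (cursor a) (ρ a) (cursor a + ρ a <? L)

  inBlock : (c r b : ℕ) → Dec (c + r < L) → Bool
  inBlock c r b (yes _) = ⌊ c ≤? b ⌋ ∧ ⌊ b <? c + r ⌋
  inBlock c r b (no _)  = (⌊ c ≤? b ⌋ ∧ ⌊ b <? L ⌋) ∨ ⌊ b <? c + r ∸ L ⌋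

  fill : ℕ → ℕ → Bool
  fill a b = inBlock (cursor a) (ρ a) b (cursor a + ρ a <? L)

  wrapped< : ∀ c r → c < L → r ≤ L → ¬ (c + r < L) → c + r ∸ L < L
  wrapped< c r c<L r≤L c+r≮L =
    subst (c + r ∸ L <_) (m+n∸n≡m L L) (∸-monoˡ-< (+-mono-<-≤ c<L r≤L) (≮⇒≥ c+r≮L))

  module Filling (ρ≤L : ∀ a → ρ a ≤ L) (L>0 : 0 < L) where

    cursor< : ∀ a → cursor a < L
    cursor< zero    = L>0
    cursor< (suc a) = next< (cursor a) (ρ a) (cursor< a) (ρ≤L a) (cursor a + ρ a <? L)
      where
      next< : ∀ c r → c < L → r ≤ L → (d : Dec (c + r < L)) → next c r d < L
      next< c r c<L r≤L (yes c+r<L) = c+r<L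
      next< c r c<L r≤L (no c+r≮L)  = wrapped< c r c<L r≤L c+r≮L

    block-size : ∀ N c r → c < L → r ≤ L → L ≤ N → (d : Dec (c + r < L)) →
      sumBelow (λ b → bit (inBlock c r b d)) N ≡ r
    block-size N c r c<L r≤L L≤N d = +-cancelʳ-≡ c _ _ (begin
      sumBelow χ N + c
        ≡⟨ cong (sumBelow χ N +_) (sym (sumBelow-[<] N c (≤-trans (<⇒≤ c<L) L≤N))) ⟩
      sumBelow χ N + sumBelow (λ b → [ b < c ]) N
        ≡⟨ sym (sumBelow-+ N χ (λ b → [ b < c ])) ⟩
      sumBelow (λ b → χ b + [ b < c ]) N
        ≡⟨ shifted d ⟩
      r + c ∎)
      where
      open ≡-Reasoning
      χ : ℕ → ℕ
      χ b = bit (inBlock c r b d)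
      shifted : (d : Dec (c + r < L)) → sumBelow (λ b → bit (inBlock c r b d) + [ b < c ]) N ≡ r + c
      shifted (yes c+r<L) = begin
        sumBelow (λ b → bit (inBlock c r b (yes c+r<L)) + [ b < c ]) N
          ≡⟨ sumBelow-ext N (λ b _ → block-[<] c r b) ⟩
        sumBelow (λ b → [ b < c + r ]) N
          ≡⟨ sumBelow-[<] N (c + r) (≤-trans (<⇒≤ c+r<L) L≤N) ⟩
        c + r
          ≡⟨ +-comm c r ⟩
        r + c ∎
      shifted (no c+r≮L) = begin
        sumBelow (λ b → bit (inBlock c r b (no c+r≮L)) + [ b < c ]) N
          ≡⟨ sumBelow-ext N (λ b _ → wrapped-block-[<] c r L b c<L (≮⇒≥ c+r≮L) r≤L) ⟩
        sumBelow (λ b → [ b < L ] + [ b < c + r ∸ L ]) N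
          ≡⟨ sumBelow-+ N (λ b → [ b < L ]) (λ b → [ b < c + r ∸ L ]) ⟩
        sumBelow (λ b → [ b < L ]) N + sumBelow (λ b → [ b < c + r ∸ L ]) N
          ≡⟨ cong₂ _+_ (sumBelow-[<] N L L≤N)
                       (sumBelow-[<] N (c + r ∸ L) (≤-trans (<⇒≤ (wrapped< c r c<L r≤L c+r≮L)) L≤N)) ⟩
        L + (c + r ∸ L)
          ≡⟨ m+[n∸m]≡n (≮⇒≥ c+r≮L) ⟩
        c + r
          ≡⟨ +-comm c r ⟩
        r + c ∎

    row-sum : ∀ N → L ≤ N → ∀ a → sumBelow (λ b → bit (fill a b)) N ≡ ρ a
    row-sum N L≤N a = block-size N (cursor a) (ρ a) (cursor< a) (ρ≤L a) L≤N (cursor a + ρ a <? L)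

    column-step : ∀ c r b → c < L → r ≤ L → b < L → (d : Dec (c + r < L)) →
      bit (inBlock c r b d) + [ b < c ] ≡ wraps c r d + [ b < next c r d ]
    column-step c r b c<L r≤L b<L (yes _)      = block-[<] c r b
    column-step c r b c<L r≤L b<L (no c+r≮L) =
      trans (wrapped-block-[<] c r L b c<L (≮⇒≥ c+r≮L) r≤L) (cong (_+ [ b < c + r ∸ L ]) ([<]-yes b<L))

    column-sum : ∀ b → b < L → ∀ A → sumBelow (λ a → bit (fill a b)) A ≡ laps A + [ b < cursor A ]
    column-sum b b<L zero    = sym ([<]-no {b} {0} λ ())
    column-sum b b<L (suc A) = begin
      sumBelow (λ a → bit (fill a b)) (suc A)
        ≡⟨ sumBelow-snoc A (λ a → bit (fill a b)) ⟩
      sumBelow (λ a → bit (fill a b)) A + bit (fill A b)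
        ≡⟨ cong (_+ bit (fill A b)) (column-sum b b<L A) ⟩
      laps A + [ b < cursor A ] + bit (fill A b)
        ≡⟨ +-assoc (laps A) _ _ ⟩
      laps A + ([ b < cursor A ] + bit (fill A b))
        ≡⟨ cong (laps A +_) (+-comm [ b < cursor A ] _) ⟩
      laps A + (bit (fill A b) + [ b < cursor A ])
        ≡⟨ cong (laps A +_) (column-step (cursor A) (ρ A) b (cursor< A) (ρ≤L A) b<L (cursor A + ρ A <? L)) ⟩
      laps A + (w + [ b < cursor (suc A) ])
        ≡⟨ sym (+-assoc (laps A) _ _) ⟩
      laps (suc A) + [ b < cursor (suc A) ] ∎
      where
      open ≡-Reasoning
      w = wraps (cursor A) (ρ A) (cursor A + ρ A <? L)

    column-sum-far : ∀ b → L ≤ b → ∀ A → sumBelow (λ a → bit (fill a b)) A ≡ 0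
    column-sum-far b L≤b A = sumBelow-zero A (λ a _ →
      cong bit (outside (cursor a) (ρ a) (cursor< a) (ρ≤L a) (cursor a + ρ a <? L)))
      where
      ∧-false : ∀ x → (x ∧ false) ≡ false
      ∧-false true  = refl
      ∧-false false = refl
      outside : ∀ c r → c < L → r ≤ L → (d : Dec (c + r < L)) → inBlock c r b d ≡ false
      outside c r c<L r≤L (yes c+r<L) with b <? c + r
      ... | yes b<c+r = ⊥-elim (<⇒≱ (<-trans b<c+r c+r<L) L≤b)
      ... | no _      = ∧-false ⌊ c ≤? b ⌋
      outside c r c<L r≤L (no c+r≮L) with b <? L | b <? c + r ∸ L
      ... | yes b<L | _       = ⊥-elim (<⇒≱ b<L L≤b)
      ... | no _    | yes b<w = ⊥-elim (<⇒≱ (<-trans b<w (wrapped< c r c<L r≤L c+r≮L)) L≤b)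
      ... | no _    | no _    = cong (_∨ false) (∧-false ⌊ c ≤? b ⌋)

    total : ∀ A → sumBelow ρ A ≡ laps A * L + cursor A
    total zero    = refl
    total (suc A) = begin
      sumBelow ρ (suc A)                       ≡⟨ sumBelow-snoc A ρ ⟩
      sumBelow ρ A + ρ A                       ≡⟨ cong (_+ ρ A) (total A) ⟩
      laps A * L + cursor A + ρ A               ≡⟨ +-assoc (laps A * L) (cursor A) (ρ A) ⟩
      laps A * L + (cursor A + ρ A)             ≡⟨ cong (laps A * L +_) (step (cursor A) (ρ A) (cursor A + ρ A <? L)) ⟩
      laps A * L + (w * L + cursor (suc A))     ≡⟨ sym (+-assoc (laps A * L) _ _) ⟩
      laps A * L + w * L + cursor (suc A)       ≡⟨ cong (_+ cursor (suc A)) (sym (*-distribʳ-+ L (laps A) _)) ⟩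
      laps (suc A) * L + cursor (suc A)         ∎
      where
      open ≡-Reasoning
      w = wraps (cursor A) (ρ A) (cursor A + ρ A <? L)
      step : ∀ c r → (d : Dec (c + r < L)) → c + r ≡ wraps c r d * L + next c r d
      step c r (yes _)     = refl
      step c r (no c+r≮L) = trans (sym (m+[n∸m]≡n (≮⇒≥ c+r≮L))) (cong (_+ (c + r ∸ L)) (sym (+-identityʳ L)))

sumBelow-positive : ∀ A (φ : ℕ → ℕ) → 0 < sumBelow φ A → Σ ℕ λ x → x < A × 0 < φ x
sumBelow-positive zero    φ ()
sumBelow-positive (suc A) φ pos with 0 <? φ 0
... | yes φ0>0 = 0 , s≤s z≤n , φ0>0
... | no φ0≯0  with sumBelow-positive A (λ x → φ (suc x)) (subst (λ z → 0 < z + sumBelow (λ x → φ (suc x)) A) φ0≡0 pos)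
  where φ0≡0 = n≤0⇒n≡0 (≮⇒≥ φ0≯0)
...   | x , x<A , φx>0 = suc x , s≤s x<A , φx>0

_[_≔_] : (ℕ → ℕ) → ℕ → ℕ → ℕ → ℕ
(ρ [ a ≔ v ]) x = if ⌊ x ≟ a ⌋ then v else ρ x

update-same : ∀ ρ a v → (ρ [ a ≔ v ]) a ≡ v
update-same ρ a v with a ≟ a
... | yes _  = refl
... | no a≢a = ⊥-elim (a≢a refl)

update-other : ∀ ρ a v x → x ≢ a → (ρ [ a ≔ v ]) x ≡ ρ x
update-other ρ a v x x≢a with x ≟ a
... | yes x≡a = ⊥-elim (x≢a x≡a)
... | no _    = refl

update-≤ : ∀ {B} ρ a v → v ≤ B → (∀ x → ρ x ≤ B) → ∀ x → (ρ [ a ≔ v ]) x ≤ B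
update-≤ ρ a v v≤B ρ≤B x with x ≟ a
... | yes _ = v≤B
... | no _  = ρ≤B x

sumBelow-update : ∀ M (F : ℕ → ℕ) ρ a v → a < M →
  sumBelow (λ x → F ((ρ [ a ≔ v ]) x)) M + F (ρ a) ≡ sumBelow (λ x → F (ρ x)) M + F v
sumBelow-update M F ρ a v a<M = begin
  sumBelow (λ x → F ((ρ [ a ≔ v ]) x)) M + F (ρ a)
    ≡⟨ sumBelow-point M a _ _ a<M (λ x _ x≢a → cong F (update-other ρ a v x x≢a)) ⟩
  sumBelow (λ x → F (ρ x)) M + F ((ρ [ a ≔ v ]) a)
    ≡⟨ cong (λ z → sumBelow (λ x → F (ρ x)) M + F z) (update-same ρ a v) ⟩
  sumBelow (λ x → F (ρ x)) M + F v ∎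
  where open ≡-Reasoning

-- Row-degree sequences: M rows of 1-degrees ρ 0, …, ρ (M − 1), each at most
-- H + 1 and with total M·H (the 1-edges of a friendly labeling of K_{M,2H}).
module Rows (M H : ℕ) where

  above below : (ℕ → ℕ) → ℕ
  above ρ = sumBelow (λ a → [ H < ρ a ]) M
  below ρ = sumBelow (λ a → [ ρ a < H ]) M

  Admissible : (ℕ → ℕ) → Set
  Admissible ρ = (∀ a → ρ a ≤ suc H) × sumBelow ρ M ≡ M * H

  above≤H*below : ∀ ρ → Admissible ρ → above ρ ≤ H * below ρ
  above≤H*below ρ (_ , Σρ) =
    subst₂ (λ p q → p ≤ H * q) (countTrue-toℕ M (λ a → ⌊ H <? ρ a ⌋)) (countTrue-toℕ M (λ a → ⌊ ρ a <? H ⌋))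
      (#above≤Y*#below {M} H (λ i → ρ (toℕ i)) (trans (sumFin-toℕ M ρ) Σρ))

  [H<]-low : ∀ {x} → x ≤ H → [ H < x ] ≡ 0
  [H<]-low x≤H = [<]-no (≤⇒≯ x≤H)

  lower-top : ∀ ρ a → a < M → ρ a ≡ suc H →
    suc (sumBelow (ρ [ a ≔ H ]) M) ≡ sumBelow ρ M × suc (above (ρ [ a ≔ H ])) ≡ above ρ ×
    below (ρ [ a ≔ H ]) ≡ below ρ
  lower-top ρ a a<M ρa≡H+1 = total , tops , bottoms
    where
    shift : ∀ (F : ℕ → ℕ) {p q} → F (suc H) ≡ p → F H ≡ q →
      sumBelow (λ x → F ((ρ [ a ≔ H ]) x)) M + p ≡ sumBelow (λ x → F (ρ x)) M + q
    shift F refl refl = subst (λ z → sumBelow (λ x → F ((ρ [ a ≔ H ]) x)) M + F z ≡ sumBelow (λ x → F (ρ x)) M + F H)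
      ρa≡H+1 (sumBelow-update M F ρ a H a<M)
    total = +-cancelʳ-≡ H _ _ (trans (sym (+-suc (sumBelow (ρ [ a ≔ H ]) M) H)) (shift (λ x → x) refl refl))
    tops = trans (+-comm 1 _) (trans (shift (λ x → [ H < x ]) ([<]-yes ≤-refl) ([H<]-low ≤-refl)) (+-identityʳ _))
    bottoms = trans (sym (+-identityʳ _))
      (trans (shift (λ x → [ x < H ]) ([<]-no (<-asym (n<1+n H))) ([<]-no (<-irrefl refl))) (+-identityʳ _))

  raise-bottom : ∀ ρ a → a < M → ρ a < H →
    sumBelow (ρ [ a ≔ suc (ρ a) ]) M ≡ suc (sumBelow ρ M) × above (ρ [ a ≔ suc (ρ a) ]) ≡ above ρ ×
    below (ρ [ a ≔ suc (ρ a) ]) ≤ below ρ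
  raise-bottom ρ a a<M ρa<H = total , tops , bottoms
    where
    ρ′ = ρ [ a ≔ suc (ρ a) ]
    shift : ∀ (F : ℕ → ℕ) → sumBelow (λ x → F (ρ′ x)) M + F (ρ a) ≡ sumBelow (λ x → F (ρ x)) M + F (suc (ρ a))
    shift F = sumBelow-update M F ρ a (suc (ρ a)) a<M
    total = +-cancelʳ-≡ (ρ a) _ _ (trans (shift (λ x → x)) (+-suc _ (ρ a)))
    tops = +-cancelʳ-≡ 0 _ _ (trans (cong (above ρ′ +_) (sym ([H<]-low (<⇒≤ ρa<H))))
             (trans (shift (λ x → [ H < x ])) (cong (above ρ +_) ([H<]-low ρa<H))))
    bottoms = +-cancelʳ-≤ 1 _ _ (begin
      below ρ′ + 1                       ≡⟨ cong (below ρ′ +_) (sym ([<]-yes ρa<H)) ⟩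
      below ρ′ + [ ρ a < H ]             ≡⟨ shift (λ x → [ x < H ]) ⟩
      below ρ + [ suc (ρ a) < H ]        ≤⟨ +-monoʳ-≤ (below ρ) (bit≤1 _) ⟩
      below ρ + 1                        ∎)
      where
      open ≤-Reasoning
      bit≤1 : ∀ b → bit b ≤ 1
      bit≤1 true  = ≤-refl
      bit≤1 false = z≤n

  -- If some entry exceeds H, some entry is below H; moving one unit from an
  -- entry H + 1 to an entry below H lowers `above` by one and keeps `below`
  -- from growing.
  move : ∀ ρ → Admissible ρ → 0 < above ρ →
    Σ (ℕ → ℕ) λ ρ′ → Admissible ρ′ × suc (above ρ′) ≡ above ρ × below ρ′ ≤ below ρ
  move ρ adm@(ρ≤H+1 , Σρ) above>0 =
    ρ′ , (bounded , Σρ′) , trans (cong suc tops′) tops , ≤-trans bottoms′ (≤-reflexive bottoms)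
    where
    below>0 : 0 < below ρ
    below>0 with below ρ | above≤H*below ρ adm
    ... | zero  | le = ⊥-elim (<⇒≱ above>0 (subst (above ρ ≤_) (*-zeroʳ H) le))
    ... | suc _ | _  = s≤s z≤n
    top = sumBelow-positive M (λ a → [ H < ρ a ]) above>0
    bot = sumBelow-positive M (λ a → [ ρ a < H ]) below>0
    a  = proj₁ top
    a′ = proj₁ bot
    a<M  = proj₁ (proj₂ top)
    a′<M = proj₁ (proj₂ bot)
    H<ρa : H < ρ a
    H<ρa = [<]-positive (proj₂ (proj₂ top))
    ρa′<H : ρ a′ < H
    ρa′<H = [<]-positive (proj₂ (proj₂ bot))
    ρ₁ = ρ [ a ≔ H ]
    ρ₁a′≡ρa′ : ρ₁ a′ ≡ ρ a′
    ρ₁a′≡ρa′ = update-other ρ a H a′ (λ a′≡a → <-asym ρa′<H (subst (λ z → H < ρ z) (sym a′≡a) H<ρa))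
    ρ₁a′<H : ρ₁ a′ < H
    ρ₁a′<H = subst (_< H) (sym ρ₁a′≡ρa′) ρa′<H
    ρ′ = ρ₁ [ a′ ≔ suc (ρ₁ a′) ]
    lowered = lower-top ρ a a<M (≤-antisym (ρ≤H+1 a) H<ρa)
    raised  = raise-bottom ρ₁ a′ a′<M ρ₁a′<H
    tops      = proj₁ (proj₂ lowered)
    bottoms   = proj₂ (proj₂ lowered)
    tops′     = proj₁ (proj₂ raised)
    bottoms′  = proj₂ (proj₂ raised)
    bounded : ∀ x → ρ′ x ≤ suc H
    bounded = update-≤ ρ₁ a′ _ (<⇒≤ (s≤s ρ₁a′<H)) (update-≤ ρ a H (n≤1+n H) ρ≤H+1)
    Σρ′ : sumBelow ρ′ M ≡ M * H
    Σρ′ = trans (proj₁ raised) (trans (proj₁ lowered) Σρ)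

  -- Starting from an admissible ρ with excess above ρ − below ρ ≥ t, repeated
  -- moves reach an admissible sequence with excess exactly t (each move lowers
  -- the excess by at most one).
  descend : ∀ k ρ → above ρ ≡ k → Admissible ρ → ∀ t → below ρ + t ≤ above ρ →
    Σ (ℕ → ℕ) λ ρ′ → Admissible ρ′ × above ρ′ ≡ below ρ′ + t
  descend zero ρ above≡0 adm t le =
    ρ , adm , trans above≡0 (sym (n≤0⇒n≡0 (subst (below ρ + t ≤_) above≡0 le)))
  descend (suc k) ρ above≡k+1 adm t le = decide (above ρ ≟ below ρ + t)
    where
    decide : Dec (above ρ ≡ below ρ + t) → Σ (ℕ → ℕ) λ ρ′ → Admissible ρ′ × above ρ′ ≡ below ρ′ + t
    decide (yes balanced)   = ρ , adm , balanced
    decide (no unbalanced)  = continue (move ρ adm (subst (0 <_) (sym above≡k+1) (s≤s z≤n)))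
      where
      continue : (Σ (ℕ → ℕ) λ ρ′ → Admissible ρ′ × suc (above ρ′) ≡ above ρ × below ρ′ ≤ below ρ) →
        Σ (ℕ → ℕ) λ ρ′ → Admissible ρ′ × above ρ′ ≡ below ρ′ + t
      continue (ρ′ , adm′ , tops , bottoms) =
        descend k ρ′ (suc-injective (trans tops above≡k+1)) adm′ t (≤-pred (begin-strict
          below ρ′ + t   ≤⟨ +-monoˡ-≤ t bottoms ⟩
          below ρ + t    <⟨ ≤∧≢⇒< le (λ e → unbalanced (sym e)) ⟩
          above ρ        ≡⟨ sym tops ⟩
          suc (above ρ′) ∎))
        where open ≤-Reasoning

  module Extremal (M>0 : 0 < M) where
    k r : ℕ
    k = quo M H
    r = rem M H

    extremal : ℕ → ℕ
    extremal a = if ⌊ a <? k ⌋ then suc H else (if ⌊ a ≟ k ⌋ then r else 0)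

    k<M : k < M
    k<M = quo<X M H M>0

    before : ∀ a → a < k → extremal a ≡ suc H
    before a a<k with a <? k
    ... | yes _   = refl
    ... | no a≮k  = ⊥-elim (a≮k a<k)

    at : extremal k ≡ r
    at with k <? k | k ≟ k
    ... | yes k<k | _      = ⊥-elim (<-irrefl refl k<k)
    ... | no _    | yes _  = refl
    ... | no _    | no k≢k = ⊥-elim (k≢k refl)

    after : ∀ a → k < a → extremal a ≡ 0
    after a k<a with a <? k | a ≟ k
    ... | yes a<k | _      = ⊥-elim (<-asym k<a a<k)
    ... | no _    | yes a≡k = ⊥-elim (<-irrefl (sym a≡k) k<a)
    ... | no _    | no _   = refl

    sum-extremal : ∀ (F : ℕ → ℕ) → sumBelow (λ a → F (extremal a)) M ≡ k * F (suc H) + F r + (M ∸ suc k) * F 0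
    sum-extremal F = sumBelow-piecewise M k (λ a → F (extremal a)) k<M
      (λ a a<k → cong F (before a a<k)) (cong F at) (λ a k<a → cong F (after a k<a))

    admissible : Admissible extremal
    admissible = bounded , total
      where
      bounded : ∀ a → extremal a ≤ suc H
      bounded a with a <? k
      ... | yes _ = ≤-refl
      ... | no _ with a ≟ k
      ...   | yes _ = <⇒≤ (rem< M H)
      ...   | no _  = z≤n
      total : sumBelow extremal M ≡ M * H
      total = begin
        sumBelow extremal M              ≡⟨ sum-extremal (λ x → x) ⟩
        k * suc H + r + (M ∸ suc k) * 0  ≡⟨ cong (k * suc H + r +_) (*-zeroʳ (M ∸ suc k)) ⟩
        k * suc H + r + 0                ≡⟨ trans (+-identityʳ _) (+-comm (k * suc H) r) ⟩
        r + k * suc H                    ≡⟨ sym (quo-rem M H) ⟩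
        M * H                            ∎
        where open ≡-Reasoning

    above-extremal : above extremal ≡ k
    above-extremal = begin
      above extremal                                      ≡⟨ sum-extremal (λ x → [ H < x ]) ⟩
      k * [ H < suc H ] + [ H < r ] + (M ∸ suc k) * [ H < 0 ]
        ≡⟨ cong₂ (λ p q → k * p + q + (M ∸ suc k) * [ H < 0 ]) ([<]-yes ≤-refl) ([H<]-low (≤-pred (rem< M H))) ⟩
      k * 1 + 0 + (M ∸ suc k) * [ H < 0 ]                 ≡⟨ cong (k * 1 + 0 +_) (cong ((M ∸ suc k) *_) ([H<]-low z≤n)) ⟩
      k * 1 + 0 + (M ∸ suc k) * 0                         ≡⟨ e k (M ∸ suc k) ⟩
      k                                                   ∎
      where
      open ≡-Reasoning
      e : ∀ k R → k * 1 + 0 + R * 0 ≡ k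
      e = solve-∀

    below-extremal : 0 < H → below extremal ≡ [ r < H ] + (M ∸ suc k)
    below-extremal H>0 = begin
      below extremal                                      ≡⟨ sum-extremal (λ x → [ x < H ]) ⟩
      k * [ suc H < H ] + [ r < H ] + (M ∸ suc k) * [ 0 < H ]
        ≡⟨ cong₂ (λ p q → k * p + [ r < H ] + (M ∸ suc k) * q) ([<]-no (<-asym (n<1+n H))) ([<]-yes H>0) ⟩
      k * 0 + [ r < H ] + (M ∸ suc k) * 1                 ≡⟨ e k [ r < H ] (M ∸ suc k) ⟩
      [ r < H ] + (M ∸ suc k)                             ∎
      where
      open ≡-Reasoning
      e : ∀ k b R → k * 0 + b + R * 1 ≡ b + R
      e = solve-∀

    [r<H]+δ : [ r < H ] + δ M H ≡ 1
    [r<H]+δ with r ≟ H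
    ... | yes r≡H = cong (_+ 1) ([<]-no (λ r<H → <-irrefl r≡H r<H))
    ... | no r≢H  = cong (_+ 0) ([<]-yes (≤∧≢⇒< (≤-pred (rem< M H)) r≢H))

    excess-extremal : 0 < H → M ≤ 2 * k + δ M H → above extremal ≡ below extremal + opt M H
    excess-extremal H>0 M≤ = begin
      above extremal                     ≡⟨ above-extremal ⟩
      k                                  ≡⟨ extremal-excess M k [ r < H ] (δ M H) k<M M≤ [r<H]+δ ⟩
      [ r < H ] + (M ∸ suc k) + opt M H  ≡⟨ cong (_+ opt M H) (sym (below-extremal H>0)) ⟩
      below extremal + opt M H           ∎
      where open ≡-Reasoning

  row-sequence : 0 < M → 0 < H → M ≤ 2 * quo M H + δ M H → ∀ t → t ≤ opt M H →
    Σ (ℕ → ℕ) λ ρ → Admissible ρ × above ρ ≡ below ρ + t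
  row-sequence M>0 H>0 M≤ t t≤opt = descend _ extremal refl admissible t (begin
    below extremal + t          ≤⟨ +-monoʳ-≤ (below extremal) t≤opt ⟩
    below extremal + opt M H    ≡⟨ sym (excess-extremal H>0 M≤) ⟩
    above extremal              ∎)
    where
    open Extremal M>0
    open ≤-Reasoning

module Realisation (M N H G : ℕ) (N≡2H : N ≡ H + H) (M≡2G : M ≡ G + G) (H>0 : 0 < H) (G>0 : 0 < G) where
  open Rows M H

  j : ℕ
  j = quo N G

  j<N : j < N
  j<N = quo<X N G (subst (0 <_) (sym N≡2H) (≤-trans H>0 (m≤m+n H H)))

  N≤2j+δ : N ≤ 2 * j + δ N G
  N≤2j+δ = subst (λ z → z ≤ 2 * quo z G + δ z G) (sym N≡2H) (even≤2quo H G G>0)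

  module Filled (ρ : ℕ → ℕ) (adm : Admissible ρ) (L : ℕ) (H<L : suc H ≤ L) (L≤N : L ≤ N) where
    open Cyclic ρ L
    open Filling (λ a → ≤-trans (proj₁ adm a) H<L) (≤-trans (s≤s z≤n) H<L)

    f : EdgeLabeling M N
    f a b = fill (toℕ a) (toℕ b)

    open Counts f
    open Even {H} {G} N≡2H M≡2G

    degL1≡ρ : ∀ a → degL1 f a ≡ ρ (toℕ a)
    degL1≡ρ a = trans (countTrue-toℕ N (λ b → fill (toℕ a) b)) (row-sum N L≤N (toℕ a))

    friendly : edgeFriendly f
    friendly = e1⇒friendly (trans (sumFin-ext degL1≡ρ) (trans (sumFin-toℕ M ρ) (proj₂ adm)))

    rows : ∀ t → above ρ ≡ below ρ + t → #above H (degL1 f) ≡ #below H (degL1 f) + t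
    rows t excess = trans above-rows (trans excess (cong (_+ t) (sym below-rows)))
      where
      above-rows : #above H (degL1 f) ≡ above ρ
      above-rows = trans (countTrue-ext (λ a → cong (λ z → ⌊ H <? z ⌋) (degL1≡ρ a)))
                         (countTrue-toℕ M (λ a → ⌊ H <? ρ a ⌋))
      below-rows : #below H (degL1 f) ≡ below ρ
      below-rows = trans (countTrue-ext (λ a → cong (λ z → ⌊ z <? H ⌋) (degL1≡ρ a)))
                         (countTrue-toℕ M (λ a → ⌊ ρ a <? H ⌋))

    value : ∀ t c → above ρ ≡ below ρ + t → #above G (degR1 f) ≡ #below G (degR1 f) + c → EBI M N (t + c)
    value t c row-excess col-excess = realises friendly t c (rows t row-excess) col-excess

    column : ℕ → ℕ
    column b = sumBelow (λ a → bit (fill a b)) M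

    columns : ∀ c → sumBelow (λ b → [ G < column b ]) N ≡ sumBelow (λ b → [ column b < G ]) N + c →
      #above G (degR1 f) ≡ #below G (degR1 f) + c
    columns c excess = trans above-cols (trans excess (cong (_+ c) (sym below-cols)))
      where
      degR1≡column : ∀ b → degR1 f b ≡ column (toℕ b)
      degR1≡column b = countTrue-toℕ M (λ a → fill a (toℕ b))
      above-cols : #above G (degR1 f) ≡ sumBelow (λ b → [ G < column b ]) N
      above-cols = trans (countTrue-ext (λ b → cong (λ z → ⌊ G <? z ⌋) (degR1≡column b)))
                         (countTrue-toℕ N (λ b → ⌊ G <? column b ⌋))
      below-cols : #below G (degR1 f) ≡ sumBelow (λ b → [ column b < G ]) N
      below-cols = trans (countTrue-ext (λ b → cong (λ z → ⌊ z <? G ⌋) (degR1≡column b)))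
                         (countTrue-toℕ N (λ b → ⌊ column b <? G ⌋))

    laps-cursor : laps M * L + cursor M ≡ N * G
    laps-cursor = trans (sym (total M)) (trans (proj₂ adm) mH≡nG)

    column-near : ∀ b → b < L → column b ≡ laps M + [ b < cursor M ]
    column-near b b<L = column-sum b b<L M

    column-far : ∀ b → L ≤ b → column b ≡ 0
    column-far b L≤b = column-sum-far b L≤b M

    -- Filling all N columns: the rows wrap exactly G times, every column has
    -- degree G and the columns have excess 0.
    balanced-columns : L ≡ N → #above G (degR1 f) ≡ #below G (degR1 f) + 0
    balanced-columns refl = columns 0 (trans (sumBelow-zero N (λ b b<N → [<]-no (<-irrefl (sym (column≡G b b<N)))))
      (sym (trans (+-identityʳ _) (sumBelow-zero N (λ b b<N → [<]-no (<-irrefl (column≡G b b<N)))))))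
      where
      N′ = N ∸ 1
      N≡1+N′ : N ≡ suc N′
      N≡1+N′ = sym (m+[n∸m]≡n {1} (≤-trans (s≤s z≤n) H<L))
      division : cursor M ≡ 0 × laps M ≡ G
      division = divmod-unique N′
        (subst (λ z → cursor M + laps M * z ≡ G * z) N≡1+N′
          (trans (+-comm (cursor M) _) (trans laps-cursor (*-comm N G))))
        (subst (cursor M <_) N≡1+N′ (cursor< M)) (s≤s z≤n)
      column≡G : ∀ b → b < N → column b ≡ G
      column≡G b b<N = begin
        column b                     ≡⟨ column-near b b<N ⟩
        laps M + [ b < cursor M ]     ≡⟨ cong₂ (λ l s → l + [ b < s ]) (proj₂ division) (proj₁ division) ⟩
        G + [ b < 0 ]                ≡⟨ cong (G +_) ([<]-no {b} {0} λ ()) ⟩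
        G + 0                        ≡⟨ +-identityʳ G ⟩
        G                            ∎
        where open ≡-Reasoning

    -- If rem N G = G, filling the first j + 1 columns leaves columns 0 … j − 1
    -- with degree G + 1, column j with degree G and the rest empty.
    full-window : rem N G ≡ G → L ≡ suc j → #above G (degR1 f) ≡ #below G (degR1 f) + opt N G
    full-window rem≡G refl = columns (opt N G) (begin
      sumBelow (λ b → [ G < column b ]) N
        ≡⟨ sumBelow-piecewise N j _ j<N (λ b b<j → [<]-yes (≤-reflexive (sym (column-low b b<j))))
             ([<]-no (<-irrefl (sym column-j))) (λ b j<b → trans (cong [ G <_] (column-far b j<b)) ([<]-no {G} {0} λ ())) ⟩
      j * 1 + 0 + R * 0
        ≡⟨ e₁ j R ⟩
      j
        ≡⟨ extremal-excess N j 0 1 j<N (subst (λ d → N ≤ 2 * j + d) (δ-yes N G rem≡G) N≤2j+δ) refl ⟩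
      R + (2 * j + 1 ∸ N)
        ≡⟨ cong (λ d → R + (2 * j + d ∸ N)) (sym (δ-yes N G rem≡G)) ⟩
      R + opt N G
        ≡⟨ cong (_+ opt N G) (sym (trans (sumBelow-piecewise N j _ j<N
             (λ b b<j → [<]-no (<-asym (subst (G <_) (sym (column-low b b<j)) ≤-refl)))
             ([<]-no (<-irrefl column-j)) (λ b j<b → trans (cong [_< G ] (column-far b j<b)) ([<]-yes G>0)))
             (e₂ j R))) ⟩
      sumBelow (λ b → [ column b < G ]) N + opt N G ∎)
      where
      open ≡-Reasoning
      R = N ∸ suc j
      e₁ : ∀ j R → j * 1 + 0 + R * 0 ≡ j
      e₁ = solve-∀
      e₂ : ∀ j R → j * 0 + 0 + R * 1 ≡ R
      e₂ = solve-∀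
      division : cursor M ≡ j × laps M ≡ G
      division = divmod-unique j (trans (+-comm (cursor M) _) (trans laps-cursor (begin
        N * G                  ≡⟨ quo-rem N G ⟩
        rem N G + j * suc G    ≡⟨ cong (_+ j * suc G) rem≡G ⟩
        G + j * suc G          ≡⟨ e G j ⟩
        j + G * suc j          ∎))) (cursor< M) ≤-refl
        where
        e : ∀ G j → G + j * suc G ≡ j + G * suc j
        e = solve-∀
      column-at : ∀ b → b < suc j → column b ≡ G + [ b < j ]
      column-at b b≤j = trans (column-near b b≤j) (cong₂ (λ l s → l + [ b < s ]) (proj₂ division) (proj₁ division))
      column-low : ∀ b → b < j → column b ≡ suc G
      column-low b b<j = trans (column-at b (<-trans b<j (n<1+n j))) (trans (cong (G +_) ([<]-yes b<j)) (+-comm G 1))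
      column-j : column j ≡ G
      column-j = trans (column-at j ≤-refl) (trans (cong (G +_) ([<]-no (<-irrefl refl))) (+-identityʳ G))

    G<laps : L ≡ j → G < laps M
    G<laps refl = ≰⇒> λ laps≤G → <-irrefl refl (begin-strict
      laps M * j + cursor M  <⟨ +-monoʳ-< (laps M * j) (cursor< M) ⟩
      laps M * j + j         ≡⟨ +-comm (laps M * j) j ⟩
      suc (laps M) * j       ≤⟨ *-monoˡ-≤ j (s≤s laps≤G) ⟩
      suc G * j              ≡⟨ *-comm (suc G) j ⟩
      j * suc G              ≤⟨ m≤n+m _ (rem N G) ⟩
      rem N G + j * suc G    ≡⟨ sym (trans laps-cursor (quo-rem N G)) ⟩
      laps M * j + cursor M  ∎)
      where open ≤-Reasoning

    -- If rem N G ≠ G, filling the first j columns wraps more than G times,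
    -- so columns 0 … j − 1 have degree above G and the rest are empty.
    short-window : rem N G ≢ G → L ≡ j → #above G (degR1 f) ≡ #below G (degR1 f) + opt N G
    short-window rem≢G refl = columns (opt N G) (begin
      sumBelow (λ b → [ G < column b ]) N
        ≡⟨ sumBelow-piecewise N j _ j<N (λ b b<j → [<]-yes (column-low b b<j))
             (trans (cong [ G <_] (column-far j ≤-refl)) ([<]-no {G} {0} λ ()))
             (λ b j<b → trans (cong [ G <_] (column-far b (<⇒≤ j<b))) ([<]-no {G} {0} λ ())) ⟩
      j * 1 + 0 + R * 0
        ≡⟨ e₁ j R ⟩
      j
        ≡⟨ extremal-excess N j 1 0 j<N (subst (λ d → N ≤ 2 * j + d) (δ-no N G rem≢G) N≤2j+δ) refl ⟩
      1 + R + (2 * j + 0 ∸ N)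
        ≡⟨ cong (λ d → 1 + R + (2 * j + d ∸ N)) (sym (δ-no N G rem≢G)) ⟩
      1 + R + opt N G
        ≡⟨ cong (_+ opt N G) (sym (trans (sumBelow-piecewise N j _ j<N
             (λ b b<j → [<]-no (<-asym (column-low b b<j)))
             (trans (cong [_< G ] (column-far j ≤-refl)) ([<]-yes G>0))
             (λ b j<b → trans (cong [_< G ] (column-far b (<⇒≤ j<b))) ([<]-yes G>0)))
             (e₂ j R))) ⟩
      sumBelow (λ b → [ column b < G ]) N + opt N G ∎)
      where
      open ≡-Reasoning
      R = N ∸ suc j
      e₁ : ∀ j R → j * 1 + 0 + R * 0 ≡ j
      e₁ = solve-∀
      e₂ : ∀ j R → j * 0 + 1 + R * 1 ≡ 1 + R
      e₂ = solve-∀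
      column-low : ∀ b → b < j → G < column b
      column-low b b<j = ≤-trans (G<laps refl) (≤-trans (m≤m+n (laps M) _) (≤-reflexive (sym (column-near b b<j))))

  M>0 : 0 < M
  M>0 = subst (0 <_) (sym M≡2G) (≤-trans G>0 (m≤m+n G G))

  H<N : suc H ≤ N
  H<N = subst (suc H ≤_) (sym N≡2H) (+-monoˡ-≤ H H>0)

  M≤2quo+δ : M ≤ 2 * quo M H + δ M H
  M≤2quo+δ = subst (λ z → z ≤ 2 * quo z H + δ z H) (sym M≡2G) (even≤2quo G H H>0)

  attain : ∀ t → t ≤ opt M H → EBI M N (t + 0)
  attain t t≤opt with row-sequence M>0 H>0 M≤2quo+δ t t≤opt
  ... | ρ , adm , excess = value t 0 excess (balanced-columns refl)
    where open Filled ρ adm N H<N ≤-refl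

  -- For H, G ≥ 2 every t + opt N G with t ≤ opt M H is a value, realised
  -- with extremal columns (a window of j or j + 1 columns).
  attain-shifted : 2 ≤ H → 2 ≤ G → ∀ t → t ≤ opt M H → EBI M N (t + opt N G)
  attain-shifted H≥2 G≥2 t t≤opt with row-sequence M>0 H>0 M≤2quo+δ t t≤opt
  ... | ρ , adm , excess = windows (rem N G ≟ G)
    where
    H<j+δ : suc H ≤ j + δ N G
    H<j+δ = subst (λ z → suc H ≤ quo z G + δ z G) (sym N≡2H) (H<quo+δ H G H≥2 G≥2)
    windows : Dec (rem N G ≡ G) → EBI M N (t + opt N G)
    windows (yes rem≡G) = value t (opt N G) excess (full-window rem≡G refl)
      where
      H<L : suc H ≤ suc j
      H<L = subst (suc H ≤_) (trans (cong (j +_) (δ-yes N G rem≡G)) (+-comm j 1)) H<j+δ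
      open Filled ρ adm (suc j) H<L j<N
    windows (no rem≢G) = value t (opt N G) excess (short-window rem≢G refl)
      where
      H<L : suc H ≤ j
      H<L = subst (suc H ≤_) (trans (cong (j +_) (δ-no N G rem≢G)) (+-identityʳ j)) H<j+δ
      open Filled ρ adm j H<L (<⇒≤ j<N)

ebi-transpose : ∀ {m n x} → EBI n m x → EBI m n x
ebi-transpose {m} {n} (f , ef , ∣v1-v0∣≡x) = fᵀ , friendly , trans swap-sides ∣v1-v0∣≡x
  where
  open Counts f
  fᵀ : EdgeLabeling m n
  fᵀ a b = f b a
  friendly : edgeFriendly fᵀ
  friendly = subst (_≤ 1) (cong₂ ∣_-_∣ (sym sum-degR1) (sym sum-degR0)) ef
  swap-sides : ∣ v1 fᵀ - v0 fᵀ ∣ ≡ ∣ v1 f - v0 f ∣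
  swap-sides = cong₂ ∣_-_∣ (+-comm (countTrue (λ a → ⌊ degL0 fᵀ a <? degL1 fᵀ a ⌋)) _)
                          (+-comm (countTrue (λ a → ⌊ degL1 fᵀ a <? degL0 fᵀ a ⌋)) _)

ebi-characterisation : ∀ {m n} H G → n ≡ H + H → m ≡ G + G → 2 ≤ H → 2 ≤ G →
  ∀ x → EBI m n x ⇔ x ≤ opt m H + opt n G
ebi-characterisation {m} {n} H G n≡2H m≡2G H≥2 G≥2 x = mk⇔
  (ebi-upper H G n≡2H m≡2G H>0 G>0 x) lower
  where
  H>0 = ≤-trans (s≤s z≤n) H≥2
  G>0 = ≤-trans (s≤s z≤n) G≥2
  lower : x ≤ opt m H + opt n G → EBI m n x
  lower x≤ with x ≤? opt m H
  ... | yes x≤opt = subst (EBI m n) (+-identityʳ x) (Realisation.attain m n H G n≡2H m≡2G H>0 G>0 x x≤opt)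
  ... | no  x≰opt = subst (EBI m n) (m∸n+n≡m (<⇒≤ (≰⇒> x≰opt)))
    (ebi-transpose (Realisation.attain-shifted n m G H m≡2G n≡2H G>0 H>0 G≥2 H≥2
      (x ∸ opt m H) (m≤n+o⇒m∸n≤o x (opt m H) x≤)))

-- The case n = 2: then opt m 1 = opt 2 G = 0, and EBI(K_{m,2}) = {0}.
opt-even-1 : ∀ G → opt (G + G) 1 ≡ 0
opt-even-1 G = begin
  2 * quo (G + G) 1 + δ (G + G) 1 ∸ (G + G)
    ≡⟨ cong₂ (λ q d → 2 * q + d ∸ (G + G)) (proj₂ division) (δ-no (G + G) 1 (λ e → 0≢1+n (trans (sym (proj₁ division)) e))) ⟩
  2 * G + 0 ∸ (G + G)                       ≡⟨ cong (_∸ (G + G)) (e G) ⟩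
  G + G ∸ (G + G)                           ≡⟨ n∸n≡0 (G + G) ⟩
  0                                         ∎
  where
  open ≡-Reasoning
  e : ∀ G → 2 * G + 0 ≡ G + G
  e = solve-∀
  division : rem (G + G) 1 ≡ 0 × quo (G + G) 1 ≡ G
  division = divmod-unique 1 (trans (sym (quo-rem (G + G) 1)) (e′ G)) (rem< (G + G) 1) (s≤s z≤n)
    where
    e′ : ∀ G → (G + G) * 1 ≡ 0 + G * 2
    e′ = solve-∀

opt-2 : ∀ G → 0 < G → opt 2 G ≡ 0
opt-2 (suc g) _ =
  cong₂ (λ q d → 2 * q + d ∸ 2) (proj₂ division) (δ-no 2 (suc g) (λ e → 1+n≢n (sym (trans (sym (proj₁ division)) e))))
  where
  e : ∀ g → 2 * suc g ≡ g + 1 * suc (suc g)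
  e = solve-∀
  division : rem 2 (suc g) ≡ g × quo 2 (suc g) ≡ 1
  division = divmod-unique (suc g) (trans (sym (quo-rem 2 (suc g))) (e g)) (rem< 2 (suc g)) (≤-trans (n<1+n g) (n≤1+n _))

ebi-K-m-2 : ∀ {m} G → m ≡ G + G → 0 < G → ∀ x → EBI m 2 x ⇔ x ≡ 0
ebi-K-m-2 {m} G m≡2G G>0 x = mk⇔
  (λ x∈EBI → n≤0⇒n≡0 (subst (x ≤_) (cong₂ _+_ (trans (cong (λ z → opt z 1) m≡2G) (opt-even-1 G)) (opt-2 G G>0))
                        (ebi-upper 1 G refl m≡2G (s≤s z≤n) G>0 x x∈EBI)))
  (λ { refl → Realisation.attain m 2 1 G refl m≡2G (s≤s z≤n) G>0 0 z≤n })

open import Data.Nat.Divisibility using (_∣_; divides)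
open import Data.Integer using (+_; _-_; +≤+) renaming (_+_ to _+ℤ_; _*_ to _*ℤ_; _≤_ to _≤ℤ_)
import Data.Integer.Properties as ℤ
import Data.Integer.Tactic.RingSolver as ℤ-Solver

integer-excess : ∀ A B k j m n d₁ d₂ → A + m ≡ 2 * k + d₁ → B + n ≡ 2 * j + d₂ →
  (+ 2) *ℤ (+ (k + j)) - (+ m) - (+ n) +ℤ + (d₁ + d₂) ≡ + (A + B)
integer-excess A B k j m n d₁ d₂ e₁ e₂ = begin
  (+ 2) *ℤ (+ (k + j)) - (+ m) - (+ n) +ℤ + (d₁ + d₂)   ≡⟨ reorder (+ 2) (+ (k + j)) (+ m) (+ n) (+ (d₁ + d₂)) ⟩
  ((+ 2) *ℤ (+ (k + j)) +ℤ + (d₁ + d₂)) - (+ m) - (+ n) ≡⟨ cong (λ z → z - (+ m) - (+ n)) casts ⟩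
  (+ (A + B) +ℤ + m +ℤ + n) - (+ m) - (+ n)             ≡⟨ cancel (+ (A + B)) (+ m) (+ n) ⟩
  + (A + B)                                             ∎
  where
  open ≡-Reasoning
  reorder : ∀ a b c d e → a *ℤ b - c - d +ℤ e ≡ (a *ℤ b +ℤ e) - c - d
  reorder = ℤ-Solver.solve-∀
  cancel : ∀ x c d → (x +ℤ c +ℤ d) - c - d ≡ x
  cancel = ℤ-Solver.solve-∀
  in-ℕ : 2 * (k + j) + (d₁ + d₂) ≡ A + B + m + n
  in-ℕ = trans (e k j d₁ d₂) (trans (cong₂ _+_ (sym e₁) (sym e₂)) (e′ A B m n))
    where
    e : ∀ k j d₁ d₂ → 2 * (k + j) + (d₁ + d₂) ≡ (2 * k + d₁) + (2 * j + d₂)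
    e = solve-∀
    e′ : ∀ A B m n → A + m + (B + n) ≡ A + B + m + n
    e′ = solve-∀
  casts : (+ 2) *ℤ (+ (k + j)) +ℤ + (d₁ + d₂) ≡ + (A + B) +ℤ + m +ℤ + n
  casts = begin
    (+ 2) *ℤ (+ (k + j)) +ℤ + (d₁ + d₂)  ≡⟨ cong (_+ℤ + (d₁ + d₂)) (sym (ℤ.pos-* 2 (k + j))) ⟩
    + (2 * (k + j)) +ℤ + (d₁ + d₂)       ≡⟨ sym (ℤ.pos-+ (2 * (k + j)) (d₁ + d₂)) ⟩
    + (2 * (k + j) + (d₁ + d₂))          ≡⟨ cong +_ in-ℕ ⟩
    + (A + B + m + n)                    ≡⟨ ℤ.pos-+ (A + B + m) n ⟩
    + (A + B + m) +ℤ + n                 ≡⟨ cong (_+ℤ + n) (ℤ.pos-+ (A + B) m) ⟩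
    + (A + B) +ℤ + m +ℤ + n              ∎

Parameters : (g h k k′ j j′ h′ g′ : ℕ) → Set
Parameters g h k k′ j j′ h′ g′ =
  k ≡ quo (g * 2) h × k′ ≡ rem (g * 2) h × j ≡ quo (h * 2) g × j′ ≡ rem (h * 2) g × h′ ≡ h × g′ ≡ g

statement-parameters : ∀ g h → Parameters g h
  ((g * 2 * (h * 2)) / (2 + h * 2)) (((g * 2 * (h * 2)) / 2) % suc ((h * 2) / 2))
  ((g * 2 * (h * 2)) / (2 + g * 2)) (((g * 2 * (h * 2)) / 2) % suc ((g * 2) / 2))
  ((h * 2) / 2) ((g * 2) / 2)
statement-parameters g h =
  trans (/-congˡ mn≡m*h*2) (m*n/o*n≡m/o (g * 2 * h) 2 (suc h)) ,
  cong₂ (λ a b → a % suc b) (trans (/-congˡ mn≡m*h*2) (m*n/n≡m (g * 2 * h) 2)) (m*n/n≡m h 2) ,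
  trans (/-congˡ mn≡n*g*2) (m*n/o*n≡m/o (h * 2 * g) 2 (suc g)) ,
  cong₂ (λ a b → a % suc b) (trans (/-congˡ mn≡n*g*2) (m*n/n≡m (h * 2 * g) 2)) (m*n/n≡m g 2) ,
  m*n/n≡m h 2 ,
  m*n/n≡m g 2
  where
  mn≡m*h*2 : g * 2 * (h * 2) ≡ g * 2 * h * 2
  mn≡m*h*2 = e g h
    where
    e : ∀ g h → g * 2 * (h * 2) ≡ g * 2 * h * 2
    e = solve-∀
  mn≡n*g*2 : g * 2 * (h * 2) ≡ h * 2 * g * 2
  mn≡n*g*2 = e g h
    where
    e : ∀ g h → g * 2 * (h * 2) ≡ h * 2 * g * 2
    e = solve-∀

-- The statement writes even numbers as a * 2 (from 2 ∣ a), the development as a + a.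
double : ∀ a → a * 2 ≡ a + a
double = solve-∀

-- The three cases of the theorem (n ≥ 4), for arbitrary names of its
-- parameters: the bound opt m h + opt n g equals 2(k + j) − m − n + δ m h + δ n g,
-- and δ m h = [k′ = h], δ n g = [j′ = g].
ebi-cases : ∀ g h → 2 ≤ g → 2 ≤ h → ∀ {k k′ j j′ h′ g′} → Parameters g h k k′ j j′ h′ g′ →
  let m = g * 2
      n = h * 2
      base = (+ 2) *ℤ (+ (k + j)) - (+ m) - (+ n)
  in ((k′ ≡ h′ × j′ ≡ g′) → ∀ x → EBI m n x ⇔ (+ x ≤ℤ base +ℤ + 2))
   × (((k′ ≡ h′ ⊎ j′ ≡ g′) × ¬ (k′ ≡ h′ × j′ ≡ g′)) → ∀ x → EBI m n x ⇔ (+ x ≤ℤ base +ℤ + 1))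
   × ((k′ < h′ × j′ < g′) → ∀ x → EBI m n x ⇔ (+ x ≤ℤ base))
ebi-cases g h g≥2 h≥2 {k} {k′} {j} {j′} {h′} {g′} (refl , refl , refl , refl , refl , refl) =
    (λ (row , col) → bounded-by (cong₂ _+_ (δ-yes m h row) (δ-yes n g col)))
  , (λ { (inj₁ row , ¬both) → bounded-by (cong₂ _+_ (δ-yes m h row) (δ-no n g (λ col → ¬both (row , col))))
       ; (inj₂ col , ¬both) → bounded-by (cong₂ _+_ (δ-no m h (λ row → ¬both (row , col))) (δ-yes n g col)) })
  , (λ (row , col) x → subst (λ z → EBI m n x ⇔ (+ x ≤ℤ z)) (ℤ.+-identityʳ base)
      (bounded-by (cong₂ _+_ (δ-no m h (λ e → <-irrefl e row)) (δ-no n g (λ e → <-irrefl e col))) x))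
  where
  m = g * 2
  n = h * 2
  base = (+ 2) *ℤ (+ (k + j)) - (+ m) - (+ n)
  -- opt involves no truncation here (even≤2quo).
  no-truncation : ∀ a b → 0 < b → opt (a * 2) b + a * 2 ≡ 2 * quo (a * 2) b + δ (a * 2) b
  no-truncation a b b>0 = m∸n+n≡m (subst (λ z → z ≤ 2 * quo z b + δ z b) (sym (double a)) (even≤2quo a b b>0))
  S≡ : base +ℤ + (δ m h + δ n g) ≡ + (opt m h + opt n g)
  S≡ = integer-excess (opt m h) (opt n g) k j m n (δ m h) (δ n g)
    (no-truncation g h (≤-trans (s≤s z≤n) h≥2)) (no-truncation h g (≤-trans (s≤s z≤n) g≥2))
  bounded-by : ∀ {d} → δ m h + δ n g ≡ d → ∀ x → EBI m n x ⇔ (+ x ≤ℤ base +ℤ + d)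
  bounded-by refl x = mk⇔
    (λ x∈EBI → subst (+ x ≤ℤ_) (sym S≡) (+≤+ (Equivalence.to characterised x∈EBI)))
    (λ x≤ → Equivalence.from characterised (ℤ.drop‿+≤+ (subst (+ x ≤ℤ_) S≡ x≤)))
    where
    characterised = ebi-characterisation h g (double h) (double g) h≥2 g≥2 x

theorem1 : (m n : ℕ) → 2 ∣ m → 2 ∣ n → 0 < n → n ≤ m →
    ((n ≡ 2) → ∀ x → EBI m n x ⇔ (x ≡ 0)) ×
    (4 ≤ n →
      let k  = (m * n) / (2 + n)
          k' = ((m * n) / 2) % suc (n / 2)
          j  = (m * n) / (2 + m)
          j' = ((m * n) / 2) % suc (m / 2)
          base = (+ 2) *ℤ (+ (k + j)) - (+ m) - (+ n)
      in ((k' ≡ n / 2 × j' ≡ m / 2) → ∀ x → EBI m n x ⇔ (+ x ≤ℤ base +ℤ + 2))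
       × (((k' ≡ n / 2 ⊎ j' ≡ m / 2) × ¬ (k' ≡ n / 2 × j' ≡ m / 2)) → ∀ x → EBI m n x ⇔ (+ x ≤ℤ base +ℤ + 1))
       × ((k' < n / 2 × j' < m / 2) → ∀ x → EBI m n x ⇔ (+ x ≤ℤ base)))
theorem1 .(g * 2) .(h * 2) (divides g refl) (divides h refl) n>0 n≤m =
  n≡2-case , λ n≥4 → ebi-cases g h (≤-trans (halve n≥4) h≤g) (halve n≥4) (statement-parameters g h)
  where
  h≤g : h ≤ g
  h≤g = *-cancelʳ-≤ h g 2 n≤m
  h>0 : 0 < h
  h>0 = ≰⇒> (λ h≤0 → <⇒≱ n>0 (*-monoˡ-≤ 2 h≤0))
  halve : 4 ≤ h * 2 → 2 ≤ h
  halve n≥4 = *-cancelʳ-≤ 2 h 2 n≥4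
  n≡2-case : h * 2 ≡ 2 → ∀ x → EBI (g * 2) (h * 2) x ⇔ (x ≡ 0)
  n≡2-case n≡2 rewrite *-cancelʳ-≡ h 1 2 n≡2 = ebi-K-m-2 g (double g) (≤-trans h>0 h≤g)
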